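{- If a finite, simple, connected maximal planar graph $G$ contains a pair of distinct alike vertices, then $G$ is a bipyramid.
   Context: Two vertices are alike if they have the same set of neighbors. A planar graph is maximal planar if it has a plane drawing in which every face is bounded by three edges. The bipyramid is the graph with vertex set $\{a_1,a_2\} \cup \{b_1,\ldots,b_m\}$ and edge set $\{a_i b_j : i \in \{1,2\}, j \in \{1,\ldots,m\}\} \cup \{b_j b_{j+1} : j \in \{1,\ldots,m\}\}$, where $b_{m+1} = b_1$. -}

module Defs where

open import Data.Nat using (ℕ; zero; suc; _+_)
open import Data.Nat.DivMod using (_/_)
open import Data.Fin using (Fin; zero; suc; inject₁; fromℕ)
open import Data.List using (List; length; filter; map; allFin)
open import Data.Nat.ListAction using (sum)
open import Data.Product using (Σ; ∃; ∃-syntax; _×_; _,_)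
open import Data.Sum using (_⊎_)
open import Data.Empty using (⊥)
open import Function using (_∘_)
open import Function.Bundles using (_↔_; _⇔_; Inverse)
open import Relation.Nullary using (¬_)
open import Relation.Binary using (Decidable)
open import Relation.Binary.PropositionalEquality using (_≡_)
open import Relation.Binary.Construct.Closure.ReflexiveTransitive using (Star)

iter : {A : Set} → (A → A) → ℕ → A → A
iter f zero    x = x
iter f (suc k) x = f (iter f k x)

record SimpleGraph (n : ℕ) : Set₁ where
  field
    Adj   : Fin n → Fin n → Set
    Adj?  : Decidable Adj
    sym   : ∀ {u v} → Adj u v → Adj v u
    irrfl : ∀ {u} → ¬ Adj u u
open SimpleGraph public

module _ {n : ℕ} (G : SimpleGraph n) where

  Connected : Set
  Connected = ∀ u v → Star (Adj G) u v

  Alike : Fin n → Fin n → Set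
  Alike u v = ∀ w → (Adj G u w ⇔ Adj G v w)

  degree : Fin n → ℕ
  degree u = length (filter (Adj? G u) (allFin n))

  -- number of darts (ordered pairs (u,v) with uv an edge) = 2|E|
  darts : ℕ
  darts = sum (map degree (allFin n))

  numEdges : ℕ
  numEdges = darts / 2

  -- A rotation system assigns to every vertex u a cyclic permutation
  -- ρ u of its neighbourhood N(u) (the clockwise order of the edges at u
  -- in a drawing).  Faces are the orbits of the face-tracing map
  -- (u , v) ↦ (v , ρ v u) on darts.

  record RotationSystem : Set where
    field
      ρ        : Fin n → Fin n → Fin n
      ρ-adj    : ∀ {u v} → Adj G u v → Adj G u (ρ u v)
      ρ-inj    : ∀ {u v w} → Adj G u v → Adj G u w → ρ u v ≡ ρ u w → v ≡ w
      ρ-cyclic : ∀ {u v w} → Adj G u v → Adj G u w →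
                 ∃[ k ] (iter (ρ u) k v ≡ w)
    faceStep : Fin n × Fin n → Fin n × Fin n
    faceStep (u , v) = (v , ρ v u)
  open RotationSystem public

  -- Every face of the embedding is bounded by exactly three edges:
  -- face tracing returns to every dart after three steps.  (A face of
  -- length 1 is impossible in a simple graph, so this means length 3.)
  AllFacesTriangles : RotationSystem → Set
  AllFacesTriangles R =
    ∀ u v → Adj G u v → faceStep R (faceStep R (faceStep R (u , v))) ≡ (u , v)

  -- When every face is a triangle, each face contains exactly 3 darts,
  -- so the number of faces is darts / 3.
  numFacesTri : ℕ
  numFacesTri = darts / 3

  -- G is maximal planar: G is connected and has a combinatorial
  -- embedding of genus 0 (Euler: V - E + F = 2) all of whose faces are
  -- bounded by three edges.
  MaximalPlanar : Set
  MaximalPlanar =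
    Connected ×
    Σ RotationSystem (λ R → AllFacesTriangles R × (n + numFacesTri ≡ numEdges + 2))

-- The bipyramid with m base vertices, on vertex set Fin (2 + m):
--   a₁ = zero, a₂ = suc zero, b_j = suc (suc j)  (j : Fin m).
-- Edges: a_i b_j for all i, j, and b_j b_{j+1} (indices mod m).

apex₁ apex₂ : ∀ {m} → Fin (2 + m)
apex₁ = zero
apex₂ = suc zero

base : ∀ {m} → Fin m → Fin (2 + m)
base j = suc (suc j)

data BipArc : (m : ℕ) → Fin (2 + m) → Fin (2 + m) → Set where
  a₁b  : ∀ {m} (j : Fin m) → BipArc m apex₁ (base j)
  a₂b  : ∀ {m} (j : Fin m) → BipArc m apex₂ (base j)
  -- b_j b_{j+1} for j < m - 1   (here m = suc k)
  step : ∀ {k} (j : Fin k) → BipArc (suc k) (base (inject₁ j)) (base (suc j))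
  wrap : ∀ {k} → BipArc (suc k) (base (fromℕ k)) (base zero)

BipAdj : (m : ℕ) → Fin (2 + m) → Fin (2 + m) → Set
BipAdj m x y = BipArc m x y ⊎ BipArc m y x

IsBipyramid : ∀ {n} → SimpleGraph n → Set
IsBipyramid {n} G =
  ∃[ m ] Σ (Fin n ↔ Fin (2 + m)) (λ f →
    ∀ u v → (Adj G u v ⇔ BipAdj m (Inverse.to f u) (Inverse.to f v)))

-- Let u ≢ v be alike, with common neighbourhood N, and let σ = ρ u and τ = ρ v be the
-- rotations at u and v, both cyclic permutations of N.  If τ (σ s) ≡ s for every s ∈ N, the
-- rotation at each s ∈ N reads u, τ s, v, σ s, so s has no further neighbours, consecutive
-- elements of the cycle σ are adjacent, and by connectivity there are no vertices outside
-- {u, v} ∪ N: G is the bipyramid over the cycle σ.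
-- Otherwise Euler's formula fails.  Trace the faces of the map induced on the subgraph E₀ of
-- edges at u or v.  Adding the missing edges back one at a time composes the tracing
-- permutation with a transposition, which changes its number of orbits by one; this gives
-- an Euler-type inequality between the orbits for E₀ and the faces of G.  Since the orbit of
-- the dart (s , u) also contains (τ (σ s) , u), a spoke moved by τ ∘ σ saves one orbit, and
-- with 3F = 2E and V − E + F = 2 that is one orbit too many.

module Submission where

open import Data.Bool using (Bool; true; false; _∨_; _∧_; if_then_else_)
open import Data.Bool.Properties using (∨-comm; ∧-comm; ∨-identityʳ; ∨-zeroʳ)
import Data.Bool.Properties as Bool
open import Data.Empty using (⊥-elim)
open import Data.Fin using (Fin; toℕ; inject₁; fromℕ<)
import Data.Fin as Fin
open import Data.Fin.Properties using (_≟_; any?; toℕ-injective; toℕ-fromℕ<; toℕ-inject₁; toℕ-fromℕ; toℕ<n; pigeonhole)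
open import Data.List using (List; []; _∷_; _++_; length; lookup; filter; map; allFin; upTo; cartesianProduct; cartesianProductWith)
open import Data.List.Extrema.Nat using (argmin; argmin-sel; f[argmin]≤v⁺)
open import Data.List.Membership.Propositional using (_∈_; lose)
import Data.List.Membership.DecPropositional as DecMembership
open import Data.List.Membership.Propositional.Properties
  using (∈-allFin; ∈-map⁺; ∈-map⁻; ∈-filter⁺; ∈-filter⁻; ∈-++⁻; ∈-upTo⁺; ∈-cartesianProduct⁺; ∈-cartesianProduct⁻; ∈-cartesianProductWith⁺)
open import Data.List.Properties using (length-map; length-++; length-upTo; length-tabulate; filter-none; filter-++)
open import Data.List.Relation.Unary.All as All using (All; []; _∷_)
open import Data.List.Relation.Unary.AllPairs using ([]; _∷_)
open import Data.List.Relation.Unary.Any using (here; there; index)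
open import Data.List.Relation.Unary.Any.Properties using (lookup-index; ¬Any[])
open import Data.List.Relation.Unary.Unique.Propositional using (Unique)
open import Data.List.Relation.Unary.Unique.Propositional.Properties using (allFin⁺; filter⁺; map⁺; ++⁺; cartesianProduct⁺)
open import Data.Nat using (ℕ; zero; suc; _+_; _*_; _∸_; _≤_; _<_; z≤n; s≤s; _<?_; _≤?_; NonZero)
open import Data.Nat.DivMod using (_/_; /-monoˡ-≤; m*n/n≡m)
open import Data.Nat.ListAction using (sum)
open import Data.Nat.Properties hiding (_≟_)
open import Data.Nat.Tactic.RingSolver using (solve-∀)
open import Data.Product using (Σ; ∃; ∃₂; _×_; _,_; proj₁; proj₂; swap)
open import Data.Product.Properties using (≡-dec; ,-injective; ,-injectiveˡ)
open import Data.Sum using (_⊎_; inj₁; inj₂)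
import Data.Sum as Sum
open import Data.Unit using (tt)
open import Function using (_∘_; Injective)
open import Function.Bundles using (_⇔_; mk⇔; Equivalence; mk↔ₛ′)
open import Relation.Binary.Construct.Closure.ReflexiveTransitive using (Star; ε; _◅_)
open import Relation.Binary.Definitions using (DecidableEquality; tri<; tri≈; tri>)
open import Relation.Binary.PropositionalEquality
open import Relation.Nullary using (¬_; Dec; yes; no; does)
open import Relation.Nullary.Decidable using (map′; _×-dec_; _⊎-dec_; ¬?; decidable-stable; dec-true; dec-false)
open import Relation.Unary using (Decidable; _⊆_; _∪_; _∩_; ∁; Empty; ｛_｝)
open import Relation.Unary.Properties using (_∪?_; _∩?_; ∁?)

open import Defs hiding (sym)

module _ {A : Set} (f : A → A) where

  iter-+ : ∀ m k x → iter f (m + k) x ≡ iter f m (iter f k x)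
  iter-+ zero    k x = refl
  iter-+ (suc m) k x = cong f (iter-+ m k x)

  iter-shift : ∀ k x → iter f k (f x) ≡ f (iter f k x)
  iter-shift zero    x = refl
  iter-shift (suc k) x = cong f (iter-shift k x)

  iter-fixed : ∀ {x} → f x ≡ x → ∀ k → iter f k x ≡ x
  iter-fixed fx≡x zero    = refl
  iter-fixed fx≡x (suc k) = trans (cong f (iter-fixed fx≡x k)) fx≡x

  iter-injective : Injective _≡_ _≡_ f → ∀ k {x y} → iter f k x ≡ iter f k y → x ≡ y
  iter-injective f-inj zero    eq = eq
  iter-injective f-inj (suc k) eq = iter-injective f-inj k (f-inj eq)

  iter-preserves : ∀ {P : A → Set} → (∀ {x} → P x → P (f x)) → ∀ k {x} → P x → P (iter f k x)
  iter-preserves     f-pres zero    px = px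
  iter-preserves {P} f-pres (suc k) px = f-pres (iter-preserves {P} f-pres k px)

  iter-reduce : ∀ {L x} → iter f (suc L) x ≡ x → ∀ k → ∃ λ i → i < suc L × iter f i x ≡ iter f k x
  iter-reduce {L} {x} per zero = 0 , s≤s z≤n , refl
  iter-reduce {L} {x} per (suc k) with iter-reduce {L} {x} per k
  ... | i , i<sL , eq with suc i <? suc L
  ...   | yes si<sL = suc i , si<sL , cong f eq
  ...   | no  si≮sL = 0 , s≤s z≤n , (begin
          x                   ≡⟨ sym per ⟩
          iter f (suc L) x    ≡⟨ cong (λ j → iter f j x) (≤-antisym (≮⇒≥ si≮sL) i<sL) ⟩
          iter f (suc i) x    ≡⟨ cong f eq ⟩
          iter f (suc k) x    ∎)
    where open ≡-Reasoning

  module _ {L x} (per : iter f (suc L) x ≡ x) (minimal : ∀ i → i < L → iter f (suc i) x ≢ x) where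

    iter-distinct-below-period : ∀ {i j} → i < j → j < suc L → iter f i x ≢ iter f j x
    iter-distinct-below-period {i} {j} i<j (s≤s j≤L) eq = minimal (L ∸ j + i) shorter (begin
      iter f (suc (L ∸ j) + i) x           ≡⟨ iter-+ (suc (L ∸ j)) i x ⟩
      iter f (suc (L ∸ j)) (iter f i x)    ≡⟨ cong (iter f (suc (L ∸ j))) eq ⟩
      iter f (suc (L ∸ j)) (iter f j x)    ≡⟨ iter-+ (suc (L ∸ j)) j x ⟨
      iter f (suc (L ∸ j + j)) x           ≡⟨ cong (λ k → iter f (suc k) x) (m∸n+n≡m j≤L) ⟩
      iter f (suc L) x                     ≡⟨ per ⟩
      x                                    ∎)
      where
      open ≡-Reasoning
      shorter : L ∸ j + i < L
      shorter = ≤-trans (+-monoʳ-< (L ∸ j) i<j) (≤-reflexive (m∸n+n≡m j≤L))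

    iter-injective-below-period : ∀ {i j} → i < suc L → j < suc L → iter f i x ≡ iter f j x → i ≡ j
    iter-injective-below-period {i} {j} i<sL j<sL eq with <-cmp i j
    ... | tri< i<j _ _ = ⊥-elim (iter-distinct-below-period i<j j<sL eq)
    ... | tri≈ _ i≡j _ = i≡j
    ... | tri> _ _ j<i = ⊥-elim (iter-distinct-below-period j<i i<sL (sym eq))

iter-cong : ∀ {A : Set} {f g : A → A} → (∀ x → f x ≡ g x) → ∀ k x → iter f k x ≡ iter g k x
iter-cong         f≗g zero    x = refl
iter-cong {f = f} f≗g (suc k) x = trans (cong f (iter-cong f≗g k x)) (f≗g _)

least-witness : ∀ {P : ℕ → Set} → Decidable P → ∀ {K} → P K →
                ∃ λ j → j ≤ K × P j × (∀ i → i < j → ¬ P i)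
least-witness P? {zero}  pK = 0 , z≤n , pK , λ _ ()
least-witness P? {suc K} pK with P? 0
... | yes p0 = 0 , z≤n , p0 , λ _ ()
... | no ¬p0 with least-witness (P? ∘ suc) pK
...   | j , j≤K , pj , below = suc j , s≤s j≤K , pj , λ where
        zero    _         → ¬p0
        (suc i) (s≤s i<j) → below i i<j

module _ {A : Set} where

  count : ∀ {P : A → Set} → Decidable P → List A → ℕ
  count P? xs = length (filter P? xs)

  module _ {P Q : A → Set} (P? : Decidable P) (Q? : Decidable Q) where

    count-mono : P ⊆ Q → ∀ xs → count P? xs ≤ count Q? xs
    count-mono P⊆Q []       = z≤n
    count-mono P⊆Q (x ∷ xs) with P? x | Q? x
    ... | yes _  | yes _ = s≤s (count-mono P⊆Q xs)
    ... | yes px | no ¬qx = ⊥-elim (¬qx (P⊆Q px))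
    ... | no _   | yes _ = m≤n⇒m≤1+n (count-mono P⊆Q xs)
    ... | no _   | no _  = count-mono P⊆Q xs

    count-mono-< : P ⊆ Q → ∀ {x xs} → x ∈ xs → Q x → ¬ P x → suc (count P? xs) ≤ count Q? xs
    count-mono-< P⊆Q {xs = y ∷ xs} (here refl) qx ¬px with P? y | Q? y
    ... | yes px | _      = ⊥-elim (¬px px)
    ... | no _   | no ¬qx = ⊥-elim (¬qx qx)
    ... | no _   | yes _  = s≤s (count-mono P⊆Q xs)
    count-mono-< P⊆Q {xs = y ∷ xs} (there x∈xs) qx ¬px with P? y | Q? y
    ... | yes _  | yes _  = s≤s (count-mono-< P⊆Q x∈xs qx ¬px)
    ... | yes py | no ¬qy = ⊥-elim (¬qy (P⊆Q py))
    ... | no _   | yes _  = m≤n⇒m≤1+n (count-mono-< P⊆Q x∈xs qx ¬px)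
    ... | no _   | no _   = count-mono-< P⊆Q x∈xs qx ¬px

    module _ {R : A → Set} (R? : Decidable R) where

      count-∪ : R ⊆ P ∪ Q → ∀ xs → count R? xs ≤ count P? xs + count Q? xs
      count-∪ R⊆P∪Q []       = z≤n
      count-∪ R⊆P∪Q (x ∷ xs) with R? x | P? x | Q? x | count-∪ R⊆P∪Q xs
      ... | no _   | no _   | no _   | ih = ih
      ... | no _   | no _   | yes _  | ih = ≤-trans ih (+-monoʳ-≤ (count P? xs) (n≤1+n _))
      ... | no _   | yes _  | no _   | ih = m≤n⇒m≤1+n ih
      ... | no _   | yes _  | yes _  | ih = m≤n⇒m≤1+n (≤-trans ih (+-monoʳ-≤ (count P? xs) (n≤1+n _)))
      ... | yes _  | yes _  | no _   | ih = s≤s ih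
      ... | yes _  | yes _  | yes _  | ih = s≤s (≤-trans ih (+-monoʳ-≤ (count P? xs) (n≤1+n _)))
      ... | yes _  | no _   | yes _  | ih = ≤-trans (s≤s ih) (≤-reflexive (sym (+-suc (count P? xs) (count Q? xs))))
      ... | yes rx | no ¬px | no ¬qx | _ with R⊆P∪Q rx
      ...   | inj₁ px = ⊥-elim (¬px px)
      ...   | inj₂ qx = ⊥-elim (¬qx qx)

      count-disjoint : P ⊆ R → Q ⊆ R → Empty (P ∩ Q) → ∀ xs → count P? xs + count Q? xs ≤ count R? xs
      count-disjoint P⊆R Q⊆R P∩Q=∅ []       = z≤n
      count-disjoint P⊆R Q⊆R P∩Q=∅ (x ∷ xs) with P? x | Q? x | R? x | count-disjoint P⊆R Q⊆R P∩Q=∅ xs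
      ... | yes px | yes qx | _      | _  = ⊥-elim (P∩Q=∅ x (px , qx))
      ... | yes px | no _   | no ¬rx | _  = ⊥-elim (¬rx (P⊆R px))
      ... | no _   | yes qx | no ¬rx | _  = ⊥-elim (¬rx (Q⊆R qx))
      ... | yes _  | no _   | yes _  | ih = s≤s ih
      ... | no _   | yes _  | yes _  | ih = ≤-trans (≤-reflexive (+-suc (count P? xs) (count Q? xs))) (s≤s ih)
      ... | no _   | no _   | yes _  | ih = m≤n⇒m≤1+n ih
      ... | no _   | no _   | no _   | ih = ih

  count-subsingleton : ∀ {P : A → Set} (P? : Decidable P) {y} → P ⊆ ｛ y ｝ →
                       ∀ {xs} → Unique xs → count P? xs ≤ 1
  count-subsingleton P? P⊆y {[]}     []             = z≤n
  count-subsingleton P? P⊆y {x ∷ xs} (x∉xs ∷ uniq) with P? x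
  ... | no _   = count-subsingleton P? P⊆y uniq
  ... | yes px = s≤s (≤-reflexive (none x∉xs))
    where
    none : ∀ {zs} → All (λ z → ¬ x ≡ z) zs → count P? zs ≡ 0
    none {[]}     []            = refl
    none {z ∷ zs} (x≢z ∷ x∉zs) with P? z
    ... | yes pz = ⊥-elim (x≢z (trans (sym (P⊆y px)) (P⊆y pz)))
    ... | no _   = none x∉zs

count-map : ∀ {A B : Set} {P : B → Set} (P? : Decidable P) (f : A → B) xs → count P? (map f xs) ≡ count (P? ∘ f) xs
count-map P? f []       = refl
count-map P? f (x ∷ xs) with P? (f x)
... | yes _ = cong suc (count-map P? f xs)
... | no _  = count-map P? f xs

count-cartesianProduct : ∀ {A B : Set} {P : A × B → Set} (P? : Decidable P) xs ys →
                         count P? (cartesianProduct xs ys) ≡ sum (map (λ x → count (λ y → P? (x , y)) ys) xs)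
count-cartesianProduct P? []       ys = refl
count-cartesianProduct P? (x ∷ xs) ys = begin
  length (filter P? (map (x ,_) ys ++ cartesianProduct xs ys))
    ≡⟨ cong length (filter-++ P? (map (x ,_) ys) (cartesianProduct xs ys)) ⟩
  length (filter P? (map (x ,_) ys) ++ filter P? (cartesianProduct xs ys))
    ≡⟨ length-++ (filter P? (map (x ,_) ys)) ⟩
  count P? (map (x ,_) ys) + count P? (cartesianProduct xs ys)
    ≡⟨ cong₂ _+_ (count-map P? (x ,_) ys) (count-cartesianProduct P? xs ys) ⟩
  count (λ y → P? (x , y)) ys + sum (map (λ x → count (λ y → P? (x , y)) ys) xs) ∎
  where open ≡-Reasoning

n*m≤o⇒m≤o/n : ∀ n {m o} .{{_ : NonZero n}} → n * m ≤ o → m ≤ o / n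
n*m≤o⇒m≤o/n n {m} nm≤o = subst (_≤ _ / n) (trans (cong (_/ n) (*-comm n m)) (m*n/n≡m m n)) (/-monoˡ-≤ n nm≤o)

o≤n*m⇒o/n≤m : ∀ n {m o} .{{_ : NonZero n}} → o ≤ n * m → o / n ≤ m
o≤n*m⇒o/n≤m n {m} o≤nm = subst (_ / n ≤_) (trans (cong (_/ n) (*-comm n m)) (m*n/n≡m m n)) (/-monoˡ-≤ n o≤nm)

length-cartesianProductWith : ∀ {A B C : Set} (f : A → B → C) xs ys →
                              length (cartesianProductWith f xs ys) ≡ length xs * length ys
length-cartesianProductWith f []       ys = refl
length-cartesianProductWith f (x ∷ xs) ys = begin
  length (map (f x) ys ++ cartesianProductWith f xs ys)  ≡⟨ length-++ (map (f x) ys) ⟩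
  length (map (f x) ys) + length (cartesianProductWith f xs ys)
    ≡⟨ cong₂ _+_ (length-map (f x) ys) (length-cartesianProductWith f xs ys) ⟩
  length ys + length xs * length ys                      ∎
  where open ≡-Reasoning

-- Orbits of a permutation of an enumerated type

_∼[_]_ : ∀ {A : Set} → A → (A → A) → A → Set
x ∼[ p ] y = ∃ λ k → iter p k x ≡ y

module _ {A : Set} {p : A → A} where

  ∼-refl : ∀ {x} → x ∼[ p ] x
  ∼-refl = 0 , refl

  ∼-trans : ∀ {x y z} → x ∼[ p ] y → y ∼[ p ] z → x ∼[ p ] z
  ∼-trans {x} (k , refl) (l , refl) = l + k , iter-+ p l k x

  ∼-cong : ∀ {q : A → A} → (∀ x → p x ≡ q x) → ∀ {x y} → x ∼[ p ] y → x ∼[ q ] y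
  ∼-cong p≗q {x} (k , refl) = k , sym (iter-cong p≗q k x)

module Enumeration {A : Set} (_≟_ : DecidableEquality A) (elements : List A)
                   (complete : ∀ x → x ∈ elements) (unique : Unique elements) where

  open DecMembership _≟_ using (_∈?_)

  ∣_∣ : ∀ {P : A → Set} → Decidable P → ℕ
  ∣ P? ∣ = count P? elements

  ∣｛x｝∣≤1 : ∀ x → ∣ x ≟_ ∣ ≤ 1
  ∣｛x｝∣≤1 x = count-subsingleton (x ≟_) (λ x≡y → x≡y) unique

  ∣∣≤length : ∀ {P : A → Set} (P? : Decidable P) L → P ⊆ (_∈ L) → ∣ P? ∣ ≤ length L
  ∣∣≤length P? []      P⊆[] =
    ≤-reflexive (cong length (filter-none P? {elements} (All.tabulate λ _ px → ¬Any[] (P⊆[] px))))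
  ∣∣≤length {P} P? (y ∷ L) P⊆y∷L = begin
    ∣ P? ∣                     ≤⟨ count-∪ (y ≟_) (_∈? L) P? split elements ⟩
    ∣ y ≟_ ∣ + ∣ _∈? L ∣       ≤⟨ +-mono-≤ (∣｛x｝∣≤1 y) (∣∣≤length (_∈? L) L λ x∈L → x∈L) ⟩
    1 + length L               ∎
    where
    open ≤-Reasoning
    split : P ⊆ ｛ y ｝ ∪ (_∈ L)
    split px with P⊆y∷L px
    ... | here x≡y   = inj₁ (sym x≡y)
    ... | there x∈L = inj₂ x∈L

  ∣∣-mono-< : ∀ {P Q : A → Set} (P? : Decidable P) (Q? : Decidable Q) → P ⊆ Q →
              ∀ {x} → Q x → ¬ P x → suc ∣ P? ∣ ≤ ∣ Q? ∣
  ∣∣-mono-< P? Q? P⊆Q qx ¬px = count-mono-< P? Q? P⊆Q (complete _) qx ¬px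

  length≤∣∣ : ∀ {P : A → Set} (P? : Decidable P) {L} → Unique L → All P L → length L ≤ ∣ P? ∣
  length≤∣∣ P? {[]}    []            []        = z≤n
  length≤∣∣ P? {y ∷ L} (y∉L ∷ uniqL) (py ∷ pL) =
    ≤-trans (s≤s (length≤∣∣ (P? ∩? ∁? (y ≟_)) uniqL (All.zip (pL , y∉L))))
            (∣∣-mono-< (P? ∩? ∁? (y ≟_)) P? proj₁ py λ (_ , y≢y) → y≢y refl)

  code : A → ℕ
  code x = toℕ (index (complete x))

  code-injective : ∀ {x y} → code x ≡ code y → x ≡ y
  code-injective {x} {y} eq = begin
    x                                        ≡⟨ lookup-index (complete x) ⟩
    lookup elements (index (complete x)) ≡⟨ cong (lookup elements) (toℕ-injective eq) ⟩
    lookup elements (index (complete y)) ≡⟨ sym (lookup-index (complete y)) ⟩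
    y                                        ∎
    where open ≡-Reasoning

  abstract
    period-exists : ∀ {p : A → A} → Injective _≡_ _≡_ p → ∀ x → ∃ λ L → iter p (suc L) x ≡ x
    period-exists {p} p-inj x
      with i , j , i<j , eq ← pigeonhole (n<1+n _) (λ i → index (complete (iter p (toℕ i) x))) =
      d ∸ 1 , (begin
        iter p (suc (d ∸ 1)) x ≡⟨ cong (λ k → iter p k x) (m+[n∸m]≡n {1} {d} (m<n⇒0<n∸m i<j)) ⟩
        iter p d x             ≡⟨ iter-injective p p-inj (toℕ i) pᵢx≡pᵢpᵈx ⟨
        x                      ∎)
      where
      open ≡-Reasoning
      d : ℕ
      d = toℕ j ∸ toℕ i
      pᵢx≡pᵢpᵈx : iter p (toℕ i) x ≡ iter p (toℕ i) (iter p d x)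
      pᵢx≡pᵢpᵈx = begin
        iter p (toℕ i) x           ≡⟨ code-injective (cong toℕ eq) ⟩
        iter p (toℕ j) x           ≡⟨ cong (λ k → iter p k x) (trans (sym (m∸n+n≡m (<⇒≤ i<j))) (+-comm d (toℕ i))) ⟩
        iter p (toℕ i + d) x       ≡⟨ iter-+ p (toℕ i) d x ⟩
        iter p (toℕ i) (iter p d x) ∎

  module Permutation (p : A → A) (p-inj : Injective _≡_ _≡_ p) where

    period : A → ℕ
    period x = proj₁ (period-exists p-inj x)

    iter-period : ∀ x → iter p (suc (period x)) x ≡ x
    iter-period x = proj₂ (period-exists p-inj x)

    abstract
      orbit : A → List A
      orbit x = map (λ i → iter p i x) (upTo (suc (period x)))

      ∼⇒∈orbit : ∀ {x y} → x ∼[ p ] y → y ∈ orbit x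
      ∼⇒∈orbit {x} (k , refl) with i , i<per , pⁱx≡pᵏx ← iter-reduce p {period x} (iter-period x) k =
        subst (_∈ orbit x) pⁱx≡pᵏx (∈-map⁺ (λ i → iter p i x) (∈-upTo⁺ i<per))

      ∈orbit⇒∼ : ∀ {x y} → y ∈ orbit x → x ∼[ p ] y
      ∈orbit⇒∼ {x} {y} y∈orbit =
        let i , _ , y≡pⁱx = ∈-map⁻ (λ i → iter p i x) {xs = upTo (suc (period x))} y∈orbit in i , sym y≡pⁱx

      _∼?_ : ∀ x y → Dec (x ∼[ p ] y)
      x ∼? y = map′ (∈orbit⇒∼ {x}) ∼⇒∈orbit (y ∈? orbit x)

      ∼-sym : ∀ {x y} → x ∼[ p ] y → y ∼[ p ] x
      ∼-sym {x} (k , refl) with i , i<per , pⁱx≡pᵏx ← iter-reduce p {period x} (iter-period x) k =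
        suc (period x) ∸ i , (begin
          iter p (suc (period x) ∸ i) (iter p k x)    ≡⟨ cong (iter p (suc (period x) ∸ i)) pⁱx≡pᵏx ⟨
          iter p (suc (period x) ∸ i) (iter p i x)    ≡⟨ iter-+ p (suc (period x) ∸ i) i x ⟨
          iter p (suc (period x) ∸ i + i) x           ≡⟨ cong (λ k → iter p k x) (m∸n+n≡m (<⇒≤ i<per)) ⟩
          iter p (suc (period x)) x                   ≡⟨ iter-period x ⟩
          x                                           ∎)
        where open ≡-Reasoning

      leader : A → A
      leader x = argmin code x (orbit x)

      ∼-leader : ∀ x → x ∼[ p ] leader x
      ∼-leader x = Sum.[ (λ leader≡x → 0 , sym leader≡x) , ∈orbit⇒∼ {x} ]′ (argmin-sel code x (orbit x))

      leader-minimal : ∀ {x y} → x ∼[ p ] y → code (leader x) ≤ code y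
      leader-minimal {x} x∼y = f[argmin]≤v⁺ {f = code} x (orbit x) (inj₂ (lose (∼⇒∈orbit x∼y) ≤-refl))

    IsLeader : A → Set
    IsLeader x = ∀ {y} → x ∼[ p ] y → code x ≤ code y

    isLeader? : Decidable IsLeader
    isLeader? x = map′ (λ x≤leader x∼y → ≤-trans x≤leader (leader-minimal x∼y))
                       (λ isLeader → isLeader (∼-leader x))
                       (code x ≤? code (leader x))

    leader-isLeader : ∀ x → IsLeader (leader x)
    leader-isLeader x leader∼y = leader-minimal (∼-trans (∼-leader x) leader∼y)

    leaders-unique : ∀ {x y} → IsLeader x → IsLeader y → x ∼[ p ] y → x ≡ y
    leaders-unique x-lead y-lead x∼y = code-injective (≤-antisym (x-lead x∼y) (y-lead (∼-sym x∼y)))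

    orbits : ℕ
    orbits = ∣ isLeader? ∣

    orbits≤∣R∣ : ∀ {R : A → Set} (R? : Decidable R) → (∀ x → ∃ λ r → R r × r ∼[ p ] x) → orbits ≤ ∣ R? ∣
    orbits≤∣R∣ R? covered = begin
      orbits                                ≤⟨ ∣∣≤length isLeader? (map leader (filter R? elements)) leader∈ ⟩
      length (map leader (filter R? elements)) ≡⟨ length-map leader (filter R? elements) ⟩
      ∣ R? ∣                                ∎
      where
      open ≤-Reasoning
      leader∈ : IsLeader ⊆ (_∈ map leader (filter R? elements))
      leader∈ {x} x-lead with r , rr , r∼x ← covered x =
        subst (_∈ map leader (filter R? elements))
              (leaders-unique (leader-isLeader r) x-lead (∼-trans (∼-sym (∼-leader r)) r∼x))
              (∈-map⁺ leader (∈-filter⁺ R? (complete r) rr))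

    ∣Q∣≤period*orbits : ∀ {Q : A → Set} (Q? : Decidable Q) → (∀ {x} → Q x → Q (p x)) →
                         ∀ k → (∀ {x} → Q x → iter p (suc k) x ≡ x) →
                         ∣ Q? ∣ ≤ suc k * ∣ isLeader? ∩? Q? ∣
    ∣Q∣≤period*orbits {Q} Q? Q-invariant k Q-periodic = begin
      ∣ Q? ∣                               ≤⟨ ∣∣≤length Q? iterates Q⊆iterates ⟩
      length iterates                      ≡⟨ length-cartesianProductWith (iter p) (upTo (suc k)) leaders ⟩
      length (upTo (suc k)) * length leaders ≡⟨ cong (_* length leaders) (length-upTo (suc k)) ⟩
      suc k * ∣ isLeader? ∩? Q? ∣           ∎
      where
      open ≤-Reasoning
      leaders iterates : List A
      leaders = filter (isLeader? ∩? Q?) elements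
      iterates = cartesianProductWith (iter p) (upTo (suc k)) leaders
      Q-leader : ∀ {x} → Q x → Q (leader x)
      Q-leader {x} qx with j , pʲx≡l ← ∼-leader x = subst Q pʲx≡l (iter-preserves p {Q} Q-invariant j qx)
      Q⊆iterates : Q ⊆ (_∈ iterates)
      Q⊆iterates {x} qx
        with j , pʲl≡x ← ∼-sym (∼-leader x)
        with i , i<sk , pⁱl≡pʲl ← iter-reduce p {k} (Q-periodic (Q-leader qx)) j =
        subst (_∈ iterates) (trans pⁱl≡pʲl pʲl≡x)
          (∈-cartesianProductWith⁺ (iter p) (∈-upTo⁺ i<sk)
            (∈-filter⁺ (isLeader? ∩? Q?) (complete (leader x)) (leader-isLeader x , Q-leader qx)))

  orbits-mono : ∀ {p q : A → A} (p-inj : Injective _≡_ _≡_ p) (q-inj : Injective _≡_ _≡_ q) →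
                (∀ {x y} → x ∼[ q ] y → x ∼[ p ] y) →
                Permutation.orbits p p-inj ≤ Permutation.orbits q q-inj
  orbits-mono p-inj q-inj q⊆p = P.orbits≤∣R∣ Q.isLeader? λ x →
    Q.leader x , Q.leader-isLeader x , q⊆p (Q.∼-sym (Q.∼-leader x))
    where
    module P = Permutation _ p-inj
    module Q = Permutation _ q-inj

  module Transposition {π π′ : A → A} (π-inj : Injective _≡_ _≡_ π) (π′-inj : Injective _≡_ _≡_ π′)
                       {a b : A} (π′a≡πb : π′ a ≡ π b) (π′b≡πa : π′ b ≡ π a)
                       (π′≡π : ∀ x → x ≢ a → x ≢ b → π′ x ≡ π x) where

    module O  = Permutation π  π-inj
    module O′ = Permutation π′ π′-inj

    iter-agree : ∀ k {y} → (∀ i → i < k → iter π i y ≢ a × iter π i y ≢ b) → iter π′ k y ≡ iter π k y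
    iter-agree zero    avoids = refl
    iter-agree (suc k) avoids = trans (cong π′ (iter-agree k λ i i<k → avoids i (m≤n⇒m≤1+n i<k)))
                                      (π′≡π _ (proj₁ (avoids k ≤-refl)) (proj₂ (avoids k ≤-refl)))

    step-∼′ : ∀ {x} → a ∼[ π′ ] x ⊎ b ∼[ π′ ] x → a ∼[ π′ ] π x ⊎ b ∼[ π′ ] π x
    step-∼′ {x} a∼′x⊎b∼′x with x ≟ a | x ≟ b
    ... | yes refl | _        = inj₂ (1 , π′b≡πa)
    ... | no _     | yes refl = inj₁ (1 , π′a≡πb)
    ... | no x≢a   | no x≢b   = Sum.map (λ ∼x → ∼-trans ∼x (1 , π′≡π x x≢a x≢b))
                                             (λ ∼x → ∼-trans ∼x (1 , π′≡π x x≢a x≢b)) a∼′x⊎b∼′x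

    a∼x⇒a∼′x⊎b∼′x : ∀ {x} → a ∼[ π ] x → a ∼[ π′ ] x ⊎ b ∼[ π′ ] x
    a∼x⇒a∼′x⊎b∼′x (zero  , refl) = inj₁ ∼-refl
    a∼x⇒a∼′x⊎b∼′x (suc k , refl) = step-∼′ (a∼x⇒a∼′x⊎b∼′x (k , refl))

    module _ (a≁b : ¬ a ∼[ π ] b) where

      joins : a ∼[ π′ ] b
      joins
        with j , _ , pʲπb≡b , below ← least-witness (λ j → iter π j (π b) ≟ b) {O.period b}
                                        (trans (iter-shift π (O.period b) b) (O.iter-period b)) =
        suc j , (begin
          iter π′ (suc j) a ≡⟨ iter-shift π′ j a ⟨
          iter π′ j (π′ a)  ≡⟨ cong (iter π′ j) π′a≡πb ⟩
          iter π′ j (π b)   ≡⟨ iter-agree j (λ i i<j → (λ pⁱπb≡a → a≁b (O.∼-sym (suc i , trans (sym (iter-shift π i b)) pⁱπb≡a)))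
                                                     , below i i<j) ⟩
          iter π j (π b)    ≡⟨ pʲπb≡b ⟩
          b                 ∎)
        where open ≡-Reasoning

      coarsens : ∀ {x y} → x ∼[ π ] y → x ∼[ π′ ] y
      coarsens (zero  , refl) = ∼-refl
      coarsens (suc k , refl) = ∼-trans (coarsens (k , refl)) (π-step (iter π k _))
        where
        π-step : ∀ w → w ∼[ π′ ] π w
        π-step w with w ≟ a | w ≟ b
        ... | yes refl | _        = ∼-trans joins (1 , π′b≡πa)
        ... | no _     | yes refl = ∼-trans (O′.∼-sym joins) (1 , π′a≡πb)
        ... | no w≢a   | no w≢b   = 1 , π′≡π w w≢a w≢b

      orbits-merge : suc O′.orbits ≤ O.orbits
      orbits-merge = ≤-trans (s≤s (O′.orbits≤∣R∣ R? covered))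
                             (∣∣-mono-< R? O.isLeader? proj₁ (O.leader-isLeader b) λ (_ , lb≢lb) → lb≢lb refl)
        where
        lb : A
        lb = O.leader b
        R? : Decidable (O.IsLeader ∩ ∁ (_≡ lb))
        R? = O.isLeader? ∩? ∁? (_≟ lb)
        la≢lb : O.leader a ≢ lb
        la≢lb la≡lb = a≁b (∼-trans (O.∼-leader a) (subst (_∼[ π ] b) (sym la≡lb) (O.∼-sym (O.∼-leader b))))
        covered : ∀ x → ∃ λ r → (O.IsLeader r × r ≢ lb) × r ∼[ π′ ] x
        covered x with O.leader x ≟ lb
        ... | no lx≢lb = O.leader x , (O.leader-isLeader x , lx≢lb) , coarsens (O.∼-sym (O.∼-leader x))
        ... | yes lx≡lb = O.leader a , (O.leader-isLeader a , la≢lb) ,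
          ∼-trans (coarsens (O.∼-sym (O.∼-leader a)))
            (∼-trans joins (coarsens (∼-trans (O.∼-leader b) (subst (_∼[ π ] x) lx≡lb (O.∼-sym (O.∼-leader x))))))

    module _ (a∼b : a ∼[ π ] b) where

      private
        Root : A → Set
        Root = (O.IsLeader ∩ ∁ (a ∼[ π ]_)) ∪ (｛ a ｝ ∪ ｛ b ｝)

        root? : Decidable Root
        root? = (O.isLeader? ∩? ∁? (a O.∼?_)) ∪? ((a ≟_) ∪? (b ≟_))

        avoids-a-b : ∀ {x} → ¬ a ∼[ π ] x → ∀ {y} → y ∼[ π ] x → y ≢ a × y ≢ b
        avoids-a-b a≁x y∼x = (λ { refl → a≁x y∼x }) , (λ { refl → a≁x (∼-trans a∼b y∼x) })

        agrees-off-orbit : ∀ {x} → ¬ a ∼[ π ] x → ∀ {y} → y ∼[ π ] x → y ∼[ π′ ] x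
        agrees-off-orbit a≁x (j , refl) =
          j , iter-agree j λ i _ → avoids-a-b a≁x (∼-trans (O.∼-sym (i , refl)) (j , refl))

        covered-by : ∀ {x} → Dec (a ∼[ π ] x) → ∃ λ r → Root r × r ∼[ π′ ] x
        covered-by (yes a∼x) = Sum.[ (λ a∼′x → a , inj₂ (inj₁ refl) , a∼′x) , (λ b∼′x → b , inj₂ (inj₂ refl) , b∼′x) ]′
                                 (a∼x⇒a∼′x⊎b∼′x a∼x)
        covered-by {x} (no a≁x) =
          O.leader x , inj₁ (O.leader-isLeader x , λ a∼l → a≁x (∼-trans a∼l l∼x)) , agrees-off-orbit a≁x l∼x
          where
          l∼x : O.leader x ∼[ π ] x
          l∼x = O.∼-sym (O.∼-leader x)

      orbits-split : O′.orbits ≤ suc O.orbits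
      orbits-split = begin
        O′.orbits                                       ≤⟨ O′.orbits≤∣R∣ root? (λ x → covered-by (a O.∼? x)) ⟩
        ∣ root? ∣                                       ≤⟨ count-∪ L? ((a ≟_) ∪? (b ≟_)) root? (λ r → r) elements ⟩
        ∣ L? ∣ + ∣ (a ≟_) ∪? (b ≟_) ∣                   ≤⟨ +-monoʳ-≤ ∣ L? ∣ (≤-trans (count-∪ (a ≟_) (b ≟_) ((a ≟_) ∪? (b ≟_)) (λ r → r) elements)
                                                                               (+-mono-≤ (∣｛x｝∣≤1 a) (∣｛x｝∣≤1 b))) ⟩
        ∣ L? ∣ + 2                                      ≡⟨ +-comm ∣ L? ∣ 2 ⟩
        suc (suc ∣ L? ∣)                                ≤⟨ s≤s (∣∣-mono-< L? O.isLeader? proj₁ (O.leader-isLeader a)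
                                                                       λ (_ , a≁la) → a≁la (O.∼-leader a)) ⟩
        suc O.orbits                                    ∎
        where
        open ≤-Reasoning
        L? : Decidable (O.IsLeader ∩ ∁ (a ∼[ π ]_))
        L? = O.isLeader? ∩? ∁? (a O.∼?_)

    orbits-≤-suc : O′.orbits ≤ suc O.orbits
    orbits-≤-suc with a O.∼? b
    ... | no a≁b  = ≤-trans (n≤1+n _) (≤-trans (orbits-merge a≁b) (n≤1+n _))
    ... | yes a∼b = orbits-split a∼b

-- Bipyramids

Next : ∀ m → Fin m → Fin m → Set
Next m i j = suc (toℕ i) ≡ toℕ j ⊎ (suc (toℕ i) ≡ m × toℕ j ≡ 0)

baseArc⇒Next : ∀ {m} {i j : Fin m} → BipArc m (base i) (base j) → Next m i j
baseArc⇒Next (step i) = inj₁ (cong suc (toℕ-inject₁ i))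
baseArc⇒Next {suc k} wrap = inj₂ (cong suc (toℕ-fromℕ k) , refl)

Next⇒baseArc : ∀ {m} {i j : Fin m} → Next m i j → BipArc m (base i) (base j)
Next⇒baseArc {suc k} {i} {j} (inj₁ 1+i≡j) =
  subst₂ (λ i j → BipArc (suc k) (base i) (base j)) inject₁i′≡i 1+i′≡j (step i′)
  where
  i<k : toℕ i < k
  i<k = ≤-pred (subst (_≤ suc k) (sym (cong suc 1+i≡j)) (toℕ<n j))
  i′ : Fin k
  i′ = fromℕ< i<k
  inject₁i′≡i : inject₁ i′ ≡ i
  inject₁i′≡i = toℕ-injective (trans (toℕ-inject₁ i′) (toℕ-fromℕ< i<k))
  1+i′≡j : Fin.suc i′ ≡ j
  1+i′≡j = toℕ-injective (trans (cong suc (toℕ-fromℕ< i<k)) 1+i≡j)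
Next⇒baseArc {suc k} {i} {j} (inj₂ (1+i≡m , j≡0)) =
  subst₂ (λ i j → BipArc (suc k) (base i) (base j))
         (toℕ-injective (trans (toℕ-fromℕ k) (suc-injective (sym 1+i≡m))))
         (toℕ-injective (sym j≡0))
         wrap

module BipyramidRecognition {n} (G : SimpleGraph n) {u v : Fin n} (u≢v : u ≢ v) (u≁v : ¬ Adj G u v)
         (alike : Alike G u v) (covers : ∀ x → x ≡ u ⊎ x ≡ v ⊎ Adj G u x)
         (σ : Fin n → Fin n) (σ-nbr : ∀ {s} → Adj G u s → Adj G u (σ s))
         (σ-cyclic : ∀ {s t} → Adj G u s → Adj G u t → ∃ λ k → iter σ k s ≡ t)
         (σ-adj : ∀ {s} → Adj G u s → Adj G s (σ s))
         (rim-adj : ∀ {s t} → Adj G u s → Adj G u t → Adj G s t → t ≡ σ s ⊎ s ≡ σ t)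
         {s₀ : Fin n} (s₀-nbr : Adj G u s₀) where

  private
    minimal-period : ∃ λ L → iter σ (suc L) s₀ ≡ s₀ × (∀ i → i < L → iter σ (suc i) s₀ ≢ s₀)
    minimal-period
      with k , σᵏσs₀≡s₀ ← σ-cyclic (σ-nbr s₀-nbr) s₀-nbr
      with L , _ , per , minimal ← least-witness (λ j → iter σ (suc j) s₀ Fin.≟ s₀) {k} (trans (sym (iter-shift σ k s₀)) σᵏσs₀≡s₀)
      = L , per , minimal

  m : ℕ
  m = suc (proj₁ minimal-period)

  iter-m : iter σ m s₀ ≡ s₀
  iter-m = proj₁ (proj₂ minimal-period)

  rim : Fin m → Fin n
  rim j = iter σ (toℕ j) s₀

  rim-nbr : ∀ j → Adj G u (rim j)
  rim-nbr j = iter-preserves σ {Adj G u} σ-nbr (toℕ j) s₀-nbr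

  index-unique : ∀ {i j} → i < m → j < m → iter σ i s₀ ≡ iter σ j s₀ → i ≡ j
  index-unique = iter-injective-below-period σ iter-m (proj₂ (proj₂ minimal-period))

  rim-surjective : ∀ {s} → Adj G u s → ∃ λ j → rim j ≡ s
  rim-surjective s-nbr with k , σᵏs₀≡s ← σ-cyclic s₀-nbr s-nbr
                       with i , i<m , σⁱs₀≡σᵏs₀ ← iter-reduce σ iter-m k =
    fromℕ< i<m , trans (cong (λ i → iter σ i s₀) (toℕ-fromℕ< i<m)) (trans σⁱs₀≡σᵏs₀ σᵏs₀≡s)

  rim-next⇒Next : ∀ i j → rim j ≡ σ (rim i) → Next m i j
  rim-next⇒Next i j eq with suc (toℕ i) <? m
  ... | yes 1+i<m = inj₁ (sym (index-unique (toℕ<n j) 1+i<m eq))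
  ... | no  1+i≮m = inj₂ (1+i≡m , index-unique (toℕ<n j) (s≤s z≤n)
                                     (trans eq (trans (cong (λ k → iter σ k s₀) 1+i≡m) iter-m)))
    where
    1+i≡m : suc (toℕ i) ≡ m
    1+i≡m = ≤-antisym (toℕ<n i) (≮⇒≥ 1+i≮m)

  Next⇒rim-next : ∀ i j → Next m i j → rim j ≡ σ (rim i)
  Next⇒rim-next i j (inj₁ 1+i≡j)          = cong (λ k → iter σ k s₀) (sym 1+i≡j)
  Next⇒rim-next i j (inj₂ (1+i≡m , j≡0)) =
    trans (cong (λ k → iter σ k s₀) j≡0) (trans (sym iter-m) (cong (λ k → iter σ k s₀) (sym 1+i≡m)))

  label : Fin n → Fin (2 + m)
  label x with covers x
  ... | inj₁ _            = apex₁
  ... | inj₂ (inj₁ _)     = apex₂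
  ... | inj₂ (inj₂ x-nbr) = base (proj₁ (rim-surjective x-nbr))

  vertex : Fin (2 + m) → Fin n
  vertex Fin.zero             = u
  vertex (Fin.suc Fin.zero)   = v
  vertex (Fin.suc (Fin.suc j)) = rim j

  vertex-label : ∀ x → vertex (label x) ≡ x
  vertex-label x with covers x
  ... | inj₁ refl         = refl
  ... | inj₂ (inj₁ refl)  = refl
  ... | inj₂ (inj₂ x-nbr) = proj₂ (rim-surjective x-nbr)

  label-vertex : ∀ i → label (vertex i) ≡ i
  label-vertex Fin.zero with covers u
  ... | inj₁ _            = refl
  ... | inj₂ (inj₁ u≡v)   = ⊥-elim (u≢v u≡v)
  ... | inj₂ (inj₂ u~u)   = ⊥-elim (irrfl G u~u)
  label-vertex (Fin.suc Fin.zero) with covers v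
  ... | inj₁ v≡u          = ⊥-elim (u≢v (sym v≡u))
  ... | inj₂ (inj₁ _)     = refl
  ... | inj₂ (inj₂ u~v)   = ⊥-elim (u≁v u~v)
  label-vertex (Fin.suc (Fin.suc j)) with covers (rim j)
  ... | inj₁ rimj≡u       = ⊥-elim (irrfl G (subst (Adj G u) rimj≡u (rim-nbr j)))
  ... | inj₂ (inj₁ rimj≡v) = ⊥-elim (u≁v (subst (Adj G u) rimj≡v (rim-nbr j)))
  ... | inj₂ (inj₂ x-nbr) =
    cong base (toℕ-injective (index-unique (toℕ<n _) (toℕ<n j) (proj₂ (rim-surjective x-nbr))))

  vertex-adjacency : ∀ i j → Adj G (vertex i) (vertex j) ⇔ BipAdj m i j
  vertex-adjacency Fin.zero Fin.zero = mk⇔ (λ u~u → ⊥-elim (irrfl G u~u)) λ { (inj₁ ()) ; (inj₂ ()) }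
  vertex-adjacency Fin.zero (Fin.suc Fin.zero) = mk⇔ (λ u~v → ⊥-elim (u≁v u~v)) λ { (inj₁ ()) ; (inj₂ ()) }
  vertex-adjacency Fin.zero (Fin.suc (Fin.suc j)) = mk⇔ (λ _ → inj₁ (a₁b j)) (λ _ → rim-nbr j)
  vertex-adjacency (Fin.suc Fin.zero) Fin.zero = mk⇔ (λ v~u → ⊥-elim (u≁v (SimpleGraph.sym G v~u))) λ { (inj₁ ()) ; (inj₂ ()) }
  vertex-adjacency (Fin.suc Fin.zero) (Fin.suc Fin.zero) = mk⇔ (λ v~v → ⊥-elim (irrfl G v~v)) λ { (inj₁ ()) ; (inj₂ ()) }
  vertex-adjacency (Fin.suc Fin.zero) (Fin.suc (Fin.suc j)) =
    mk⇔ (λ _ → inj₁ (a₂b j)) (λ _ → Equivalence.to (alike (rim j)) (rim-nbr j))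
  vertex-adjacency (Fin.suc (Fin.suc i)) Fin.zero = mk⇔ (λ _ → inj₂ (a₁b i)) (λ _ → SimpleGraph.sym G (rim-nbr i))
  vertex-adjacency (Fin.suc (Fin.suc i)) (Fin.suc Fin.zero) =
    mk⇔ (λ _ → inj₂ (a₂b i)) (λ _ → SimpleGraph.sym G (Equivalence.to (alike (rim i)) (rim-nbr i)))
  vertex-adjacency (Fin.suc (Fin.suc i)) (Fin.suc (Fin.suc j)) = mk⇔ to from
    where
    to : Adj G (rim i) (rim j) → BipAdj m (base i) (base j)
    to rimi~rimj with rim-adj (rim-nbr i) (rim-nbr j) rimi~rimj
    ... | inj₁ eq = inj₁ (Next⇒baseArc (rim-next⇒Next i j eq))
    ... | inj₂ eq = inj₂ (Next⇒baseArc (rim-next⇒Next j i eq))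
    from : BipAdj m (base i) (base j) → Adj G (rim i) (rim j)
    from (inj₁ arc) = subst (Adj G (rim i)) (sym (Next⇒rim-next i j (baseArc⇒Next arc))) (σ-adj (rim-nbr i))
    from (inj₂ arc) = SimpleGraph.sym G
      (subst (Adj G (rim j)) (sym (Next⇒rim-next j i (baseArc⇒Next arc))) (σ-adj (rim-nbr j)))

  isBipyramid : IsBipyramid G
  isBipyramid = m , mk↔ₛ′ label vertex label-vertex vertex-label , λ x y →
    subst₂ (λ x′ y′ → Adj G x′ y′ ⇔ BipAdj m (label x) (label y)) (vertex-label x) (vertex-label y)
           (vertex-adjacency (label x) (label y))

-- Subgraphs of a triangulation and their face tracing

Pair : ℕ → Set
Pair n = Fin n × Fin n

module Vertices (n : ℕ) = Enumeration _≟_ (allFin n) ∈-allFin (allFin⁺ n)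

pairs : ∀ n → List (Pair n)
pairs n = cartesianProduct (allFin n) (allFin n)

module Pairs (n : ℕ) = Enumeration (≡-dec _≟_ _≟_) (pairs n)
  (λ (x , y) → ∈-cartesianProduct⁺ (∈-allFin x) (∈-allFin y)) (cartesianProduct⁺ (allFin⁺ n) (allFin⁺ n))

∣graph∣≤∣domain∣ : ∀ {n} {Q : Fin n → Set} (Q? : Decidable Q) (f : Fin n → Fin n) →
                  Pairs.∣_∣ n (λ (x , y) → Q? x ×-dec (y ≟ f x)) ≤ Vertices.∣_∣ n Q?
∣graph∣≤∣domain∣ {n} Q? f = ≤-trans
  (Pairs.∣∣≤length n _ (map (λ x → x , f x) (filter Q? (allFin n)))
     λ { {x , _} (qx , refl) → ∈-map⁺ (λ x → x , f x) (∈-filter⁺ Q? (∈-allFin x) qx) })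
  (≤-reflexive (length-map (λ x → x , f x) (filter Q? (allFin n))))

module _ {n} (G : SimpleGraph n) where

  leaving-edge : ∀ {P : Fin n → Set} → Decidable P → ∀ {a b} → Star (Adj G) a b → P a → ¬ P b →
                 ∃₂ λ x y → Adj G x y × P x × ¬ P y
  leaving-edge P? ε                pa ¬pb = ⊥-elim (¬pb pa)
  leaving-edge P? (_◅_ {j = c} a~c c⋯b) pa ¬pb with P? c
  ... | yes pc = leaving-edge P? c⋯b pc ¬pb
  ... | no ¬pc = _ , c , a~c , pa , ¬pc

true≢false : true ≢ false
true≢false ()

record Subgraph (n : ℕ) : Set where
  field
    edge     : Fin n → Fin n → Bool
    edge-sym : ∀ x y → edge x y ≡ edge y x
open Subgraph

module _ {n : ℕ} where

  isPair : Fin n → Fin n → Fin n → Fin n → Bool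
  isPair a b x y = does (x ≟ a) ∧ does (y ≟ b)

  isPair-refl : ∀ a b → isPair a b a b ≡ true
  isPair-refl a b with a ≟ a | b ≟ b
  ... | yes _ | yes _ = refl
  ... | no a≢a | _    = ⊥-elim (a≢a refl)
  ... | yes _ | no b≢b = ⊥-elim (b≢b refl)

  isPair-≢ : ∀ {a b x y} → (x , y) ≢ (a , b) → isPair a b x y ≡ false
  isPair-≢ {a} {b} {x} {y} xy≢ab with x ≟ a | y ≟ b
  ... | yes refl | yes refl = ⊥-elim (xy≢ab refl)
  ... | yes _    | no _     = refl
  ... | no _     | _        = refl

  full : Subgraph n
  full = record { edge = λ _ _ → true ; edge-sym = λ _ _ → refl }

  addEdge : Subgraph n → Fin n → Fin n → Subgraph n
  addEdge E a b = record
    { edge     = λ x y → edge E x y ∨ (isPair a b x y ∨ isPair b a x y)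
    ; edge-sym = λ x y → cong₂ _∨_ (edge-sym E x y)
        (trans (∨-comm (isPair a b x y) _) (cong₂ _∨_ (∧-comm (does (x ≟ b)) _) (∧-comm (does (x ≟ a)) _)))
    }

  star : ∀ {X : Fin n → Set} → Decidable X → Subgraph n
  star X? = record { edge = λ x y → does (X? x) ∨ does (X? y) ; edge-sym = λ x y → ∨-comm (does (X? x)) _ }

  module _ {X : Fin n → Set} (X? : Decidable X) where

    star-tail : ∀ {x} → X x → ∀ y → edge (star X?) x y ≡ true
    star-tail {x} Xx y rewrite dec-true (X? x) Xx = refl

    star-head : ∀ {y} → X y → ∀ x → edge (star X?) x y ≡ true
    star-head {y} Xy x rewrite dec-true (X? y) Xy = ∨-zeroʳ (does (X? x))

    star-off : ∀ {x y} → ¬ X x → ¬ X y → edge (star X?) x y ≡ false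
    star-off {x} {y} ¬Xx ¬Xy rewrite dec-false (X? x) ¬Xx | dec-false (X? y) ¬Xy = refl

  module _ (E : Subgraph n) (a b : Fin n) where

    addEdge-ab : edge (addEdge E a b) a b ≡ true
    addEdge-ab rewrite isPair-refl a b = ∨-zeroʳ (edge E a b)

    addEdge-ba : edge (addEdge E a b) b a ≡ true
    addEdge-ba rewrite isPair-refl b a = trans (cong (edge E b a ∨_) (∨-zeroʳ _)) (∨-zeroʳ (edge E b a))

    addEdge-other : ∀ {x y} → (x , y) ≢ (a , b) → (x , y) ≢ (b , a) → edge (addEdge E a b) x y ≡ edge E x y
    addEdge-other xy≢ab xy≢ba rewrite isPair-≢ xy≢ab | isPair-≢ xy≢ba = ∨-identityʳ _

    addEdge-⊇ : ∀ {x y} → edge E x y ≡ true → edge (addEdge E a b) x y ≡ true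
    addEdge-⊇ exy rewrite exy = refl

module TriangulatedEmbedding {n} (G : SimpleGraph n) (R : RotationSystem G) (triangles : AllFacesTriangles G R) where

  open Pairs n
  module V = Vertices n

  adj-sym : ∀ {x y} → Adj G x y → Adj G y x
  adj-sym = SimpleGraph.sym G

  adj-≢ : ∀ {x y} → Adj G x y → x ≢ y
  adj-≢ x~x refl = irrfl G x~x

  ρ[ρyx]y≡x : ∀ {x y} → Adj G x y → ρ R (ρ R y x) y ≡ x
  ρ[ρyx]y≡x {x} {y} x~y = cong proj₁ (triangles x y x~y)

  ρx[ρyx]≡y : ∀ {x y} → Adj G x y → ρ R x (ρ R y x) ≡ y
  ρx[ρyx]≡y {x} {y} x~y =
    trans (cong (λ z → ρ R z (ρ R y x)) (sym (ρ[ρyx]y≡x x~y))) (cong proj₂ (triangles x y x~y))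

  third-adj : ∀ {x y} → Adj G x y → Adj G x (ρ R y x)
  third-adj {x} {y} x~y = adj-sym (subst (Adj G (ρ R y x)) (ρ[ρyx]y≡x x~y) (ρ-adj R (adj-sym (ρ-adj R (adj-sym x~y)))))

  IsDart : Pair n → Set
  IsDart (x , y) = Adj G x y

  isDart? : Decidable IsDart
  isDart? (x , y) = Adj? G x y

  ∣isDart∣≡darts : ∣ isDart? ∣ ≡ darts G
  ∣isDart∣≡darts = count-cartesianProduct isDart? (allFin n) (allFin n)

  -- Face tracing of the map induced on E: follow the face boundary along darts of E and turn
  -- around the tail at the other darts of G.  The orbits are the faces of that map (each with
  -- the remaining darts of G in its corners), one rotation per vertex untouched by E, and the
  -- fixed non-darts.
  trace : Subgraph n → Pair n → Pair n
  trace E (x , y) with Adj? G x y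
  ... | no _  = x , y
  ... | yes _ = if edge E x y then (y , ρ R y x) else (x , ρ R x y)

  module _ (E : Subgraph n) where

    trace-nondart : ∀ {p} → ¬ IsDart p → trace E p ≡ p
    trace-nondart {x , y} ¬x~y with Adj? G x y
    ... | yes x~y = ⊥-elim (¬x~y x~y)
    ... | no _    = refl

    trace-in : ∀ {x y} → Adj G x y → edge E x y ≡ true → trace E (x , y) ≡ (y , ρ R y x)
    trace-in {x} {y} x~y exy with Adj? G x y
    ... | no ¬x~y = ⊥-elim (¬x~y x~y)
    ... | yes _ rewrite exy = refl

    trace-out : ∀ {x y} → Adj G x y → edge E x y ≡ false → trace E (x , y) ≡ (x , ρ R x y)
    trace-out {x} {y} x~y exy with Adj? G x y
    ... | no ¬x~y = ⊥-elim (¬x~y x~y)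
    ... | yes _ rewrite exy = refl

    trace-dart : ∀ {p} → IsDart p → IsDart (trace E p)
    trace-dart {x , y} x~y with edge E x y in exy
    ... | true  rewrite trace-in x~y exy  = ρ-adj R (adj-sym x~y)
    ... | false rewrite trace-out x~y exy = ρ-adj R x~y

    trace-injective-on-darts : ∀ {x y x′ y′} → Adj G x y → Adj G x′ y′ → trace E (x , y) ≡ trace E (x′ , y′) → (x , y) ≡ (x′ , y′)
    trace-injective-on-darts {x} {y} {x′} {y′} x~y x′~y′ eq with edge E x y in exy | edge E x′ y′ in ex′y′
    ... | true | true with refl , ρ≡ρ ← ,-injective (trans (sym (trace-in x~y exy)) (trans eq (trace-in x′~y′ ex′y′))) =
      cong (_, y) (ρ-inj R (adj-sym x~y) (adj-sym x′~y′) ρ≡ρ)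
    ... | false | false with refl , ρ≡ρ ← ,-injective (trans (sym (trace-out x~y exy)) (trans eq (trace-out x′~y′ ex′y′))) =
      cong (x ,_) (ρ-inj R x~y x′~y′ ρ≡ρ)
    ... | true | false with refl , ρ≡ρ ← ,-injective (trans (sym (trace-in x~y exy)) (trans eq (trace-out x′~y′ ex′y′)))
      with refl ← ρ-inj R (adj-sym x~y) x′~y′ ρ≡ρ = ⊥-elim (true≢false (trans (sym exy) (trans (edge-sym E x y) ex′y′)))
    ... | false | true with refl , ρ≡ρ ← ,-injective (trans (sym (trace-out x~y exy)) (trans eq (trace-in x′~y′ ex′y′)))
      with refl ← ρ-inj R x~y (adj-sym x′~y′) ρ≡ρ = ⊥-elim (true≢false (trans (sym ex′y′) (trans (edge-sym E x′ y′) exy)))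

    trace-injective : Injective _≡_ _≡_ (trace E)
    trace-injective {p} {q} eq = by-dartness (isDart? p) (isDart? q)
      where
      by-dartness : Dec (IsDart p) → Dec (IsDart q) → p ≡ q
      by-dartness (no ¬p)   (no ¬q)    = trans (sym (trace-nondart ¬p)) (trans eq (trace-nondart ¬q))
      by-dartness (no ¬p)   (yes q)    = ⊥-elim (¬p (subst IsDart (trans (sym eq) (trace-nondart ¬p)) (trace-dart q)))
      by-dartness (yes p)   (no ¬q)    = ⊥-elim (¬q (subst IsDart (trans eq (trace-nondart ¬q)) (trace-dart p)))
      by-dartness (yes x~y) (yes x′~y′) = trace-injective-on-darts x~y x′~y′ eq

  trace-rotates : ∀ E {x y} → Adj G x y → ∀ k → (∀ i → i < k → edge E x (iter (ρ R x) i y) ≡ false) →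
                  iter (trace E) k (x , y) ≡ (x , iter (ρ R x) k y)
  trace-rotates E x~y zero    outside = refl
  trace-rotates E x~y (suc k) outside =
    trans (cong (trace E) (trace-rotates E x~y k λ i i<k → outside i (m≤n⇒m≤1+n i<k)))
          (trace-out E (iter-preserves (ρ R _) {Adj G _} (ρ-adj R) k x~y) (outside k ≤-refl))

  trace-cong : ∀ {E E′ : Subgraph n} {x y} → (Adj G x y → edge E x y ≡ edge E′ x y) → trace E (x , y) ≡ trace E′ (x , y)
  trace-cong {E} {E′} {x} {y} same with Adj? G x y
  ... | no _    = refl
  ... | yes x~y rewrite same x~y = refl

  module Trace (E : Subgraph n) = Permutation (trace E) (trace-injective E)

  orbitsOf : Subgraph n → ℕ
  orbitsOf E = Trace.orbits E

  Outside : Subgraph n → Pair n → Set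
  Outside E (x , y) = Adj G x y × edge E x y ≡ false

  outside? : ∀ E → Decidable (Outside E)
  outside? E (x , y) = Adj? G x y ×-dec (edge E x y Bool.≟ false)

  Touched : Subgraph n → Fin n → Set
  Touched E x = ∃ λ y → Adj G x y × edge E x y ≡ true

  touched? : ∀ E → Decidable (Touched E)
  touched? E x = any? λ y → Adj? G x y ×-dec (edge E x y Bool.≟ true)

  untouched-edge : ∀ E {x y} → ¬ Touched E x → Adj G x y → edge E x y ≡ false
  untouched-edge E {x} {y} ¬touched x~y with edge E x y in exy
  ... | false = refl
  ... | true  = ⊥-elim (¬touched (y , x~y , exy))

  -- Euler's inequality for the map induced on E, measured against the faces of G (for E = full
  -- it is trivial); it is carried down to smaller E one edge at a time.
  EulerInequality : Subgraph n → Set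
  EulerInequality E = 2 * orbitsOf full + 4 * V.∣ ∁? (touched? E) ∣ ≤ 2 * orbitsOf E + ∣ outside? E ∣

  module AddEdge (E : Subgraph n) {a b} (a~b : Adj G a b) (eab : edge E a b ≡ false) where

    E′ : Subgraph n
    E′ = addEdge E a b

    eba : edge E b a ≡ false
    eba = trans (edge-sym E b a) eab

    trace-ab : trace E′ (a , b) ≡ trace E (b , a)
    trace-ab = trans (trace-in E′ a~b (addEdge-ab E a b)) (sym (trace-out E (adj-sym a~b) eba))

    trace-ba : trace E′ (b , a) ≡ trace E (a , b)
    trace-ba = trans (trace-in E′ (adj-sym a~b) (addEdge-ba E a b)) (sym (trace-out E a~b eab))

    trace-other : ∀ p → p ≢ (a , b) → p ≢ (b , a) → trace E′ p ≡ trace E p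
    trace-other (x , y) xy≢ab xy≢ba = trace-cong λ _ → addEdge-other E a b xy≢ab xy≢ba

    open Transposition (trace-injective E) (trace-injective E′) trace-ab trace-ba trace-other public

    touched-grows : ∀ {t} → Touched E t → Touched E′ t
    touched-grows (s , t~s , ets) = s , t~s , addEdge-⊇ E a b ets

    outside-shrinks : 2 + ∣ outside? E′ ∣ ≤ ∣ outside? E ∣
    outside-shrinks = ≤-trans (s≤s (∣∣-mono-< (outside? E′) outside∪ba? inj₁ (inj₂ refl) ¬outside′-ba))
                              (∣∣-mono-< outside∪ba? (outside? E) ⊆outside (a~b , eab) ¬outside∪ba-ab)
      where
      outside∪ba? : Decidable (Outside E′ ∪ ｛ (b , a) ｝)
      outside∪ba? p = outside? E′ p ⊎-dec ≡-dec _≟_ _≟_ (b , a) p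
      ⊆outside : Outside E′ ∪ ｛ (b , a) ｝ ⊆ Outside E
      ⊆outside {x , y} (inj₁ (x~y , e′xy)) = x~y , Bool.∨-conicalˡ (edge E x y) _ e′xy
      ⊆outside (inj₂ refl) = adj-sym a~b , eba
      ¬outside′-ba : ¬ Outside E′ (b , a)
      ¬outside′-ba (_ , e′ba) = true≢false (trans (sym (addEdge-ba E a b)) e′ba)
      ¬outside∪ba-ab : ¬ (Outside E′ ∪ ｛ (b , a) ｝) (a , b)
      ¬outside∪ba-ab (inj₁ (_ , e′ab)) = true≢false (trans (sym (addEdge-ab E a b)) e′ab)
      ¬outside∪ba-ab (inj₂ ba≡ab)      = adj-≢ a~b (,-injectiveˡ (sym ba≡ab))

  trace-keeps-untouched : ∀ {E w} → ¬ Touched E w → ∀ y → proj₁ (trace E (w , y)) ≡ w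
  trace-keeps-untouched {E} {w} ¬touched y = by-dartness (isDart? (w , y))
    where
    by-dartness : Dec (Adj G w y) → proj₁ (trace E (w , y)) ≡ w
    by-dartness (no ¬w~y) = cong proj₁ (trace-nondart E ¬w~y)
    by-dartness (yes w~y) = cong proj₁ (trace-out E w~y (untouched-edge E ¬touched w~y))

  orbit-stays-at-untouched : ∀ {E w} → ¬ Touched E w → ∀ k y → proj₁ (iter (trace E) k (w , y)) ≡ w
  orbit-stays-at-untouched {E} {w} ¬touched k y =
    iter-preserves (trace E) {λ p → proj₁ p ≡ w} (λ { {w , y} refl → trace-keeps-untouched ¬touched y }) k refl

  module _ (connected : Connected G) {t₀ : Fin n} where

    private
      Smaller : Subgraph n → Set
      Smaller E = ∀ E′ → Touched E′ t₀ → ∣ outside? E′ ∣ < ∣ outside? E ∣ → EulerInequality E′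

    euler-across-bridge : ∀ E → Touched E t₀ → Smaller E →
                          ∀ {x w} → Adj G x w → Touched E x → ¬ Touched E w → EulerInequality E
    euler-across-bridge E t₀-touched smaller {x} {w} x~w x-touched ¬w-touched = begin
      2 * orbitsOf full + 4 * V.∣ ∁? (touched? E) ∣      ≤⟨ +-monoʳ-≤ (2 * orbitsOf full) (*-monoʳ-≤ 4 untouched-bound) ⟩
      2 * orbitsOf full + 4 * (V.∣ ∁? (touched? E′) ∣ + 1) ≡⟨ rearrange₁ (2 * orbitsOf full) V.∣ ∁? (touched? E′) ∣ ⟩
      (2 * orbitsOf full + 4 * V.∣ ∁? (touched? E′) ∣) + 4 ≤⟨ +-monoˡ-≤ 4 (smaller E′ (touched-grows t₀-touched) (≤-trans (n≤1+n _) outside-shrinks)) ⟩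
      (2 * orbitsOf E′ + ∣ outside? E′ ∣) + 4             ≡⟨ rearrange₂ (orbitsOf E′) ∣ outside? E′ ∣ ⟩
      2 * suc (orbitsOf E′) + (2 + ∣ outside? E′ ∣)        ≤⟨ +-mono-≤ (*-monoʳ-≤ 2 (orbits-merge xw≁wx)) outside-shrinks ⟩
      2 * orbitsOf E + ∣ outside? E ∣                      ∎
      where
      open ≤-Reasoning
      rearrange₁ : ∀ a m → a + 4 * (m + 1) ≡ (a + 4 * m) + 4
      rearrange₁ = solve-∀
      rearrange₂ : ∀ z r → (2 * z + r) + 4 ≡ 2 * suc z + (2 + r)
      rearrange₂ = solve-∀
      exw : edge E x w ≡ false
      exw = trans (edge-sym E x w) (untouched-edge E ¬w-touched (adj-sym x~w))
      open AddEdge E x~w exw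
      xw≁wx : ¬ (x , w) ∼[ trace E ] (w , x)
      xw≁wx xw∼wx with k , eq ← O.∼-sym xw∼wx =
        adj-≢ x~w (trans (sym (cong proj₁ eq)) (orbit-stays-at-untouched ¬w-touched k x))
      untouched-bound : V.∣ ∁? (touched? E) ∣ ≤ V.∣ ∁? (touched? E′) ∣ + 1
      untouched-bound = ≤-trans (count-∪ (∁? (touched? E′)) (w ≟_) (∁? (touched? E)) split (allFin n))
                                (+-monoʳ-≤ _ (V.∣｛x｝∣≤1 w))
        where
        split : ∁ (Touched E) ⊆ ∁ (Touched E′) ∪ ｛ w ｝
        split {y} ¬y-touched with w ≟ y
        ... | yes w≡y = inj₂ w≡y
        ... | no w≢y  = inj₁ λ (z , y~z , e′yz) → true≢false (trans (sym e′yz)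
                          (trans (addEdge-other E x w (λ yz≡xw → ¬y-touched (subst (Touched E) (sym (,-injectiveˡ yz≡xw)) x-touched))
                                                      (λ yz≡wx → w≢y (sym (,-injectiveˡ yz≡wx))))
                                 (untouched-edge E ¬y-touched y~z)))

    untouched-none : ∀ E → (∀ y → Touched E y) → V.∣ ∁? (touched? E) ∣ ≤ 0
    untouched-none E all-touched = V.∣∣≤length (∁? (touched? E)) [] λ ¬touched → ⊥-elim (¬touched (all-touched _))

    euler-inner-edge : ∀ E → Smaller E → (∀ y → Touched E y) → ∀ {a b} → Outside E (a , b) → EulerInequality E
    euler-inner-edge E smaller all-touched {a} {b} (a~b , eab) = begin
      2 * orbitsOf full + 4 * V.∣ ∁? (touched? E) ∣   ≤⟨ +-monoʳ-≤ (2 * orbitsOf full) (*-monoʳ-≤ 4 (untouched-none E all-touched)) ⟩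
      2 * orbitsOf full + 4 * 0                       ≤⟨ +-monoʳ-≤ (2 * orbitsOf full) z≤n ⟩
      2 * orbitsOf full + 4 * V.∣ ∁? (touched? E′) ∣  ≤⟨ smaller E′ (touched-grows (all-touched t₀)) (≤-trans (n≤1+n _) outside-shrinks) ⟩
      2 * orbitsOf E′ + ∣ outside? E′ ∣               ≤⟨ +-monoˡ-≤ ∣ outside? E′ ∣ (*-monoʳ-≤ 2 orbits-≤-suc) ⟩
      2 * suc (orbitsOf E) + ∣ outside? E′ ∣          ≡⟨ rearrange (orbitsOf E) ∣ outside? E′ ∣ ⟩
      2 * orbitsOf E + (2 + ∣ outside? E′ ∣)          ≤⟨ +-monoʳ-≤ (2 * orbitsOf E) outside-shrinks ⟩
      2 * orbitsOf E + ∣ outside? E ∣                 ∎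
      where
      open ≤-Reasoning
      open AddEdge E a~b eab
      rearrange : ∀ z r → 2 * suc z + r ≡ 2 * z + (2 + r)
      rearrange = solve-∀

    euler-no-outside : ∀ E → (∀ y → Touched E y) → (∀ x y → ¬ Outside E (x , y)) → EulerInequality E
    euler-no-outside E all-touched no-outside = begin
      2 * orbitsOf full + 4 * V.∣ ∁? (touched? E) ∣   ≤⟨ +-monoʳ-≤ (2 * orbitsOf full) (*-monoʳ-≤ 4 (untouched-none E all-touched)) ⟩
      2 * orbitsOf full + 4 * 0                       ≡⟨ +-identityʳ (2 * orbitsOf full) ⟩
      2 * orbitsOf full                               ≤⟨ *-monoʳ-≤ 2 (orbits-mono (trace-injective full) (trace-injective E)
                                                                       (∼-cong traceE≗tracefull)) ⟩
      2 * orbitsOf E                                  ≤⟨ m≤m+n (2 * orbitsOf E) ∣ outside? E ∣ ⟩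
      2 * orbitsOf E + ∣ outside? E ∣                 ∎
      where
      open ≤-Reasoning
      traceE≗tracefull : ∀ p → trace E p ≡ trace full p
      traceE≗tracefull (x , y) = trace-cong λ x~y → Bool.¬-not λ exy≡false → no-outside x y (x~y , exy≡false)

    euler-step : ∀ E → Touched E t₀ → Smaller E → EulerInequality E
    euler-step E t₀-touched smaller = by-bridge (any? λ x → any? λ w → Adj? G x w ×-dec touched? E x ×-dec ¬? (touched? E w))
      where
      by-inner : (∀ y → Touched E y) → Dec (∃ λ a → ∃ λ b → Outside E (a , b)) → EulerInequality E
      by-inner all-touched (yes (a , b , outside)) = euler-inner-edge E smaller all-touched outside
      by-inner all-touched (no no-outside)         = euler-no-outside E all-touched λ a b outside → no-outside (a , b , outside)
      by-bridge : Dec (∃ λ x → ∃ λ w → Adj G x w × Touched E x × ¬ Touched E w) → EulerInequality E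
      by-bridge (yes (x , w , x~w , x-touched , ¬w-touched)) = euler-across-bridge E t₀-touched smaller x~w x-touched ¬w-touched
      by-bridge (no no-bridge) = by-inner all-touched (any? λ a → any? λ b → outside? E (a , b))
        where
        all-touched : ∀ y → Touched E y
        all-touched y = decidable-stable (touched? E y) λ ¬y-touched →
          no-bridge (leaving-edge G (touched? E) (connected t₀ y) t₀-touched ¬y-touched)

    euler-inequality-below : ∀ K E → Touched E t₀ → ∣ outside? E ∣ < K → EulerInequality E
    euler-inequality-below (suc K) E t₀-touched r<1+K = euler-step E t₀-touched λ E′ t₀-touched′ r′<r →
      euler-inequality-below K E′ t₀-touched′ (≤-trans r′<r (≤-pred r<1+K))

    euler-inequality : ∀ E → Touched E t₀ → EulerInequality E
    euler-inequality E t₀-touched = euler-inequality-below (suc ∣ outside? E ∣) E t₀-touched ≤-refl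

  module Φ = Trace full

  faces : ℕ
  faces = ∣ Φ.isLeader? ∩? isDart? ∣

  trace-full-is-faceStep : ∀ {x y} → Adj G x y → trace full (x , y) ≡ faceStep R (x , y)
  trace-full-is-faceStep x~y = trace-in full x~y refl

  trace-full-period : ∀ {p} → IsDart p → iter (trace full) 3 p ≡ p
  trace-full-period {x , y} x~y = begin
    trace full (trace full (trace full (x , y))) ≡⟨ cong (trace full ∘ trace full) (trace-full-is-faceStep x~y) ⟩
    trace full (trace full (faceStep R (x , y))) ≡⟨ cong (trace full) (trace-full-is-faceStep d₁) ⟩
    trace full (faceStep R (faceStep R (x , y))) ≡⟨ trace-full-is-faceStep d₂ ⟩
    faceStep R (faceStep R (faceStep R (x , y))) ≡⟨ triangles x y x~y ⟩
    (x , y)                                      ∎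
    where
    open ≡-Reasoning
    d₁ : IsDart (faceStep R (x , y))
    d₁ = ρ-adj R (adj-sym x~y)
    d₂ : IsDart (faceStep R (faceStep R (x , y)))
    d₂ = ρ-adj R (adj-sym d₁)

  darts≤3*faces : darts G ≤ 3 * faces
  darts≤3*faces = subst (_≤ 3 * faces) ∣isDart∣≡darts
    (Φ.∣Q∣≤period*orbits isDart? (trace-dart full) 2 trace-full-period)

  nondarts+faces≤orbits : ∣ ∁? isDart? ∣ + faces ≤ orbitsOf full
  nondarts+faces≤orbits = count-disjoint (∁? isDart?) (Φ.isLeader? ∩? isDart?) Φ.isLeader? nondart-leader proj₁
                                         (λ _ (¬dart , _ , dart) → ¬dart dart) (pairs n)
    where
    nondart-leader : ∀ {p} → ¬ IsDart p → Φ.IsLeader p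
    nondart-leader ¬dart (k , refl) = ≤-reflexive (cong code (sym (iter-fixed (trace full) (trace-nondart full ¬dart) k)))

-- Two alike vertices

module AlikeVertices {n} (G : SimpleGraph n) (R : RotationSystem G) (triangles : AllFacesTriangles G R)
                     (connected : Connected G) {u v : Fin n} (u≢v : u ≢ v) (alike : Alike G u v) where

  open TriangulatedEmbedding G R triangles
  open Pairs n

  σ τ : Fin n → Fin n
  σ = ρ R u
  τ = ρ R v

  S : Fin n → Set
  S = Adj G u

  S⇒v~ : ∀ {x} → S x → Adj G v x
  S⇒v~ {x} = Equivalence.to (alike x)

  v~⇒S : ∀ {x} → Adj G v x → S x
  v~⇒S {x} = Equivalence.from (alike x)

  u≁v : ¬ Adj G u v
  u≁v u~v = irrfl G (S⇒v~ u~v)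

  UV : Fin n → Set
  UV x = u ≡ x ⊎ v ≡ x

  uv? : Decidable UV
  uv? x = (u ≟ x) ⊎-dec (v ≟ x)

  S⇒¬UV : ∀ {x} → S x → ¬ UV x
  S⇒¬UV u~x (inj₁ refl) = irrfl G u~x
  S⇒¬UV u~x (inj₂ refl) = u≁v u~x

  S~UV : ∀ {c x} → UV c → S x → Adj G x c
  S~UV (inj₁ refl) u~x = adj-sym u~x
  S~UV (inj₂ refl) u~x = adj-sym (S⇒v~ u~x)

  σ-nbr : ∀ {s} → S s → S (σ s)
  σ-nbr = ρ-adj R

  τ-nbr : ∀ {s} → S s → S (τ s)
  τ-nbr u~s = v~⇒S (ρ-adj R (S⇒v~ u~s))

  ρ[s][σs]≡u : ∀ {s} → S s → ρ R s (σ s) ≡ u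
  ρ[s][σs]≡u u~s = ρx[ρyx]≡y (adj-sym u~s)

  σ[ρsu]≡s : ∀ {s} → S s → σ (ρ R s u) ≡ s
  σ[ρsu]≡s u~s = ρx[ρyx]≡y u~s

  ρ[s][τs]≡v : ∀ {s} → S s → ρ R s (τ s) ≡ v
  ρ[s][τs]≡v u~s = ρx[ρyx]≡y (adj-sym (S⇒v~ u~s))

  τ[ρsv]≡s : ∀ {s} → S s → τ (ρ R s v) ≡ s
  τ[ρsv]≡s u~s = ρx[ρyx]≡y (S⇒v~ u~s)

  ρ[s]u-nbr : ∀ {s} → S s → S (ρ R s u)
  ρ[s]u-nbr = third-adj

  E₀ : Subgraph n
  E₀ = star uv?

  module T₀ = Trace E₀

  _∼₀_ : Pair n → Pair n → Set
  p ∼₀ q = p ∼[ trace E₀ ] q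

  enter-spoke : ∀ {c x} → UV c → S x → trace E₀ (c , x) ≡ (x , ρ R x c)
  enter-spoke UVc u~x = trace-in E₀ (adj-sym (S~UV UVc u~x)) (star-tail uv? UVc _)

  turn-around-spoke : ∀ {c d x} → UV c → UV d → c ≢ d → (∀ {y} → UV y → y ≢ c → y ≡ d) → S x → (c , x) ∼₀ (x , d)
  turn-around-spoke {c} {d} {x} UVc UVd c≢d other u~x
    with ρ-cyclic R (S~UV UVc u~x) (S~UV UVd u~x)
  ... | zero  , c≡d = ⊥-elim (c≢d c≡d)
  ... | suc m , ρˢᵐc≡d
    with j , j≤m , UV-hit , below ← least-witness (λ j → uv? (iter (ρ R x) (suc j) c)) {m} (subst UV (sym ρˢᵐc≡d) UVd) =
    suc j , (begin
      iter (trace E₀) (suc j) (c , x)         ≡⟨ iter-shift (trace E₀) j (c , x) ⟨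
      iter (trace E₀) j (trace E₀ (c , x))    ≡⟨ cong (iter (trace E₀) j) (enter-spoke UVc u~x) ⟩
      iter (trace E₀) j (x , ρ R x c)         ≡⟨ trace-rotates E₀ (ρ-adj R (S~UV UVc u~x)) j rotating ⟩
      (x , iter (ρ R x) j (ρ R x c))          ≡⟨ cong (x ,_) (trans (iter-shift (ρ R x) j c) (other UV-hit not-back)) ⟩
      (x , d)                                 ∎)
    where
    open ≡-Reasoning
    rotating : ∀ i → i < j → edge E₀ x (iter (ρ R x) i (ρ R x c)) ≡ false
    rotating i i<j = star-off uv? (S⇒¬UV u~x) λ UV-early → below i i<j (subst UV (iter-shift (ρ R x) i c) UV-early)
    not-back : iter (ρ R x) (suc j) c ≢ c
    not-back back with iter-reduce (ρ R x) {j} back (suc m)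
    ... | zero  , _         , c≡ρˢᵐc = c≢d (trans c≡ρˢᵐc ρˢᵐc≡d)
    ... | suc i , s≤s i<j , ρˢⁱc≡ρˢᵐc = below i i<j (subst UV (sym (trans ρˢⁱc≡ρˢᵐc ρˢᵐc≡d)) UVd)

  u→v-around : ∀ {x} → S x → (u , x) ∼₀ (x , v)
  u→v-around = turn-around-spoke (inj₁ refl) (inj₂ refl) u≢v λ { (inj₁ refl) u≢u → ⊥-elim (u≢u refl) ; (inj₂ refl) _ → refl }

  v→u-around : ∀ {x} → S x → (v , x) ∼₀ (x , u)
  v→u-around = turn-around-spoke (inj₂ refl) (inj₁ refl) (u≢v ∘ sym) λ { (inj₁ refl) _ → refl ; (inj₂ refl) v≢v → ⊥-elim (v≢v refl) }

  τσ-saves : ∀ {s} → S s → (s , u) ∼₀ (τ (σ s) , u)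
  τσ-saves {s} u~s =
    ∼-trans (1 , trace-in E₀ (adj-sym u~s) (star-head uv? (inj₁ refl) s))
   (∼-trans (u→v-around (σ-nbr u~s))
   (∼-trans (1 , trace-in E₀ (adj-sym (S⇒v~ (σ-nbr u~s))) (star-head uv? (inj₂ refl) (σ s)))
            (v→u-around (τ-nbr (σ-nbr u~s)))))

  around-spoke : ∀ {x} → S x → ∀ k → (u , x) ∼₀ (x , iter (ρ R x) (suc k) u) ⊎ (v , x) ∼₀ (x , iter (ρ R x) (suc k) u)
  around-spoke u~x zero    = inj₁ (1 , enter-spoke (inj₁ refl) u~x)
  around-spoke {x} u~x (suc k) = extend (uv? y) (around-spoke u~x k)
    where
    y : Fin n
    y = iter (ρ R x) (suc k) u
    extend : Dec (UV y) → (u , x) ∼₀ (x , y) ⊎ (v , x) ∼₀ (x , y) →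
           (u , x) ∼₀ (x , ρ R x y) ⊎ (v , x) ∼₀ (x , ρ R x y)
    extend (yes (inj₁ u≡y)) _ = inj₁ (1 , trans (enter-spoke (inj₁ refl) u~x) (cong (λ c → x , ρ R x c) u≡y))
    extend (yes (inj₂ v≡y)) _ = inj₂ (1 , trans (enter-spoke (inj₂ refl) u~x) (cong (λ c → x , ρ R x c) v≡y))
    extend (no ¬UVy) = Sum.map (λ ∼y → ∼-trans ∼y turn) (λ ∼y → ∼-trans ∼y turn)
      where
      x~y : Adj G x y
      x~y = iter-preserves (ρ R x) {Adj G x} (ρ-adj R) (suc k) (adj-sym u~x)
      turn : (x , y) ∼₀ (x , ρ R x y)
      turn = 1 , trace-out E₀ x~y (star-off uv? (S⇒¬UV u~x) ¬UVy)

  Near : Fin n → Set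
  Near x = UV x ⊎ S x

  near? : Decidable Near
  near? x = uv? x ⊎-dec Adj? G u x

  enter-u : ∀ {s} → S s → (ρ R s u , u) ∼₀ (u , s)
  enter-u u~s = 1 , trans (trace-in E₀ (adj-sym (ρ[s]u-nbr u~s)) (star-head uv? (inj₁ refl) _)) (cong (u ,_) (σ[ρsu]≡s u~s))

  from-spoke-root : ∀ {x y} → Near x → Adj G x y → ∃ λ s → S s × (s , u) ∼₀ (x , y)
  from-spoke-root (inj₁ (inj₁ refl)) u~y = ρ R _ u , ρ[s]u-nbr u~y , enter-u u~y
  from-spoke-root (inj₁ (inj₂ refl)) v~y = _ , v~⇒S v~y , T₀.∼-sym (v→u-around (v~⇒S v~y))
  from-spoke-root {x} (inj₂ u~x) x~y with ρ-cyclic R (adj-sym u~x) x~y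
  ... | zero  , refl = x , u~x , ∼-refl
  ... | suc k , refl = Sum.[ (λ u∼ → ρ R x u , ρ[s]u-nbr u~x , ∼-trans (enter-u u~x) u∼)
                           , (λ v∼ → x , u~x , ∼-trans (T₀.∼-sym (v→u-around u~x)) v∼) ]′
                           (around-spoke u~x k)

  Far : Fin n → Set
  Far = ∁ Near

  far? : Decidable Far
  far? x = ¬? (near? x)

  far-untouched : ∀ {x} → Far x → ¬ Touched E₀ x
  far-untouched far (y , x~y , e₀xy) = true≢false (trans (sym e₀xy) (star-off uv? (far ∘ inj₁) ¬UVy))
    where
    ¬UVy : ¬ UV _
    ¬UVy (inj₁ refl) = far (inj₂ (adj-sym x~y))
    ¬UVy (inj₂ refl) = far (inj₂ (v~⇒S (adj-sym x~y)))

  some-neighbour : Fin n → Fin n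
  some-neighbour x with any? (Adj? G x)
  ... | yes (y , _) = y
  ... | no _        = x

  some-neighbour-adj : ∀ {x y} → Adj G x y → Adj G x (some-neighbour x)
  some-neighbour-adj {x} {y} x~y with any? (Adj? G x)
  ... | yes (_ , x~z) = x~z
  ... | no none       = ⊥-elim (none (y , x~y))

  around-far : ∀ {x y} → Far x → Adj G x y → (x , some-neighbour x) ∼₀ (x , y)
  around-far {x} far x~y with k , ρᵏ≡y ← ρ-cyclic R (some-neighbour-adj x~y) x~y =
    k , trans (trace-rotates E₀ (some-neighbour-adj x~y) k λ i _ →
                 untouched-edge E₀ (far-untouched far) (iter-preserves (ρ R x) {Adj G x} (ρ-adj R) i (some-neighbour-adj x~y)))
              (cong (x ,_) ρᵏ≡y)

  spokes : List (Pair n)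
  spokes = cartesianProduct (u ∷ v ∷ []) (filter (Adj? G u) (allFin n))

  spoke-shape : ∀ {p} → p ∈ spokes → UV (proj₁ p) × S (proj₂ p)
  spoke-shape {c , s} c,s∈ with c∈uv , s∈S ← ∈-cartesianProduct⁻ (u ∷ v ∷ []) (filter (Adj? G u) (allFin n)) c,s∈ =
    centre c∈uv , proj₂ (∈-filter⁻ (Adj? G u) {xs = allFin n} s∈S)
    where
    centre : c ∈ (u ∷ v ∷ []) → UV c
    centre (here c≡u)         = inj₁ (sym c≡u)
    centre (there (here c≡v)) = inj₂ (sym c≡v)

  E₀Dart : Pair n → Set
  E₀Dart (x , y) = Adj G x y × edge E₀ x y ≡ true

  e₀Dart? : Decidable E₀Dart
  e₀Dart? (x , y) = Adj? G x y ×-dec (edge E₀ x y Bool.≟ true)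

  4*degree≤∣E₀Dart∣ : 4 * degree G u ≤ ∣ e₀Dart? ∣
  4*degree≤∣E₀Dart∣ = subst (_≤ ∣ e₀Dart? ∣) length≡ (length≤∣∣ e₀Dart? unique (All.tabulate both-ways))
    where
    unique : Unique (spokes ++ map swap spokes)
    unique = ++⁺ spokes-unique (map⁺ (cong swap) spokes-unique) λ (c,s∈ , c,s∈swapped) →
      let s′ , s′∈ , c,s≡ = ∈-map⁻ swap c,s∈swapped
      in S⇒¬UV (proj₂ (spoke-shape s′∈)) (subst UV (,-injectiveˡ c,s≡) (proj₁ (spoke-shape c,s∈)))
      where
      spokes-unique : Unique spokes
      spokes-unique = cartesianProduct⁺ ((u≢v ∷ []) ∷ [] ∷ []) (filter⁺ (Adj? G u) (allFin⁺ n))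
    both-ways : ∀ {p} → p ∈ spokes ++ map swap spokes → E₀Dart p
    both-ways p∈ with ∈-++⁻ spokes p∈
    ... | inj₁ c,s∈ with UVc , u~s ← spoke-shape c,s∈ = adj-sym (S~UV UVc u~s) , star-tail uv? UVc _
    ... | inj₂ s,c∈ with q , q∈ , refl ← ∈-map⁻ swap s,c∈ with UVc , u~s ← spoke-shape q∈ = S~UV UVc u~s , star-head uv? UVc _
    length≡ : length (spokes ++ map swap spokes) ≡ 4 * degree G u
    length≡ = begin
      length (spokes ++ map swap spokes)      ≡⟨ length-++ spokes ⟩
      length spokes + length (map swap spokes) ≡⟨ cong (length spokes +_) (length-map swap spokes) ⟩
      length spokes + length spokes           ≡⟨ cong (λ l → l + l) (length-cartesianProductWith _,_ (u ∷ v ∷ []) (filter (Adj? G u) (allFin n))) ⟩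
      2 * degree G u + 2 * degree G u         ≡⟨ double (degree G u) ⟩
      4 * degree G u                          ∎
      where
      open ≡-Reasoning
      double : ∀ k → 2 * k + 2 * k ≡ 4 * k
      double = solve-∀

  outside₀+4*degree≤darts : ∣ outside? E₀ ∣ + 4 * degree G u ≤ darts G
  outside₀+4*degree≤darts = begin
    ∣ outside? E₀ ∣ + 4 * degree G u  ≤⟨ +-monoʳ-≤ ∣ outside? E₀ ∣ 4*degree≤∣E₀Dart∣ ⟩
    ∣ outside? E₀ ∣ + ∣ e₀Dart? ∣     ≤⟨ count-disjoint (outside? E₀) e₀Dart? isDart? proj₁ proj₁
                                           (λ _ ((_ , off) , (_ , on)) → true≢false (trans (sym on) off)) (pairs n) ⟩
    ∣ isDart? ∣                        ≡⟨ ∣isDart∣≡darts ⟩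
    darts G                            ∎
    where open ≤-Reasoning

  vertices≤far+2+degree : n ≤ V.∣ far? ∣ + (2 + degree G u)
  vertices≤far+2+degree = begin
    n                                       ≡⟨ length-tabulate (λ x → x) ⟨
    length (allFin n)                       ≤⟨ V.length≤∣∣ (λ _ → yes tt) (allFin⁺ n) (All.tabulate λ _ → tt) ⟩
    V.∣ (λ _ → yes tt) ∣                    ≤⟨ count-∪ far? near? (λ _ → yes tt) (λ {x} _ → far-or-near x) (allFin n) ⟩
    V.∣ far? ∣ + V.∣ near? ∣                ≤⟨ +-monoʳ-≤ V.∣ far? ∣ (count-∪ uv? (Adj? G u) near? (λ near → near) (allFin n)) ⟩
    V.∣ far? ∣ + (V.∣ uv? ∣ + degree G u)   ≤⟨ +-monoʳ-≤ V.∣ far? ∣ (+-monoˡ-≤ (degree G u) ∣UV∣≤2) ⟩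
    V.∣ far? ∣ + (2 + degree G u)           ∎
    where
    open ≤-Reasoning
    far-or-near : ∀ x → (Far ∪ Near) x
    far-or-near x with near? x
    ... | yes near = inj₂ near
    ... | no far   = inj₁ far
    ∣UV∣≤2 : V.∣ uv? ∣ ≤ 2
    ∣UV∣≤2 = ≤-trans (count-∪ (u ≟_) (v ≟_) uv? (λ uv → uv) (allFin n)) (+-mono-≤ (V.∣｛x｝∣≤1 u) (V.∣｛x｝∣≤1 v))

  far≤untouched₀ : V.∣ far? ∣ ≤ V.∣ ∁? (touched? E₀) ∣
  far≤untouched₀ = count-mono far? (∁? (touched? E₀)) far-untouched (allFin n)

  u-touched₀ : Touched E₀ u
  u-touched₀ with connected u v
  ... | ε                      = ⊥-elim (u≢v refl)
  ... | _◅_ {j = c} u~c _      = c , u~c , star-tail uv? (inj₁ refl) c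

  module _ {s₀} (u~s₀ : S s₀) (τσs₀≢s₀ : τ (σ s₀) ≢ s₀) where

    private
      s* : Fin n
      s* = τ (σ s₀)

    S′ : Fin n → Set
    S′ = S ∩ ∁ ｛ s* ｝

    S′? : Decidable S′
    S′? = Adj? G u ∩? ∁? (s* ≟_)

    FarRoot SpokeRoot : Pair n → Set
    FarRoot (x , y) = Far x × y ≡ some-neighbour x
    SpokeRoot (x , y) = S′ x × y ≡ u

    farRoot? : Decidable FarRoot
    farRoot? (x , y) = far? x ×-dec (y ≟ some-neighbour x)

    spokeRoot? : Decidable SpokeRoot
    spokeRoot? (x , y) = S′? x ×-dec (y ≟ u)

    covered : ∀ p → ∃ λ r → (∁ IsDart ∪ (FarRoot ∪ SpokeRoot)) r × r ∼₀ p
    covered (x , y) = by-dart (isDart? (x , y))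
      where
      from-root : ∀ {s} → S s → (s , u) ∼₀ (x , y) → ∃ λ r → (∁ IsDart ∪ (FarRoot ∪ SpokeRoot)) r × r ∼₀ (x , y)
      from-root {s} u~s s∼ with s* ≟ s
      ... | no s*≢s = (s , u) , inj₂ (inj₂ ((u~s , s*≢s) , refl)) , s∼
      ... | yes refl = (s₀ , u) , inj₂ (inj₂ ((u~s₀ , τσs₀≢s₀) , refl)) , ∼-trans (τσ-saves u~s₀) s∼
      by-near : Adj G x y → Dec (Near x) → ∃ λ r → (∁ IsDart ∪ (FarRoot ∪ SpokeRoot)) r × r ∼₀ (x , y)
      by-near x~y (yes near) with s , u~s , s∼ ← from-spoke-root near x~y = from-root u~s s∼
      by-near x~y (no far) = (x , some-neighbour x) , inj₂ (inj₁ (far , refl)) , around-far far x~y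
      by-dart : Dec (Adj G x y) → ∃ λ r → (∁ IsDart ∪ (FarRoot ∪ SpokeRoot)) r × r ∼₀ (x , y)
      by-dart (no ¬x~y) = (x , y) , inj₁ ¬x~y , ∼-refl
      by-dart (yes x~y) = by-near x~y (near? x)

    orbits₀-bound : orbitsOf E₀ ≤ ∣ ∁? isDart? ∣ + (V.∣ far? ∣ + V.∣ S′? ∣)
    orbits₀-bound = begin
      orbitsOf E₀                                              ≤⟨ T₀.orbits≤∣R∣ roots? covered ⟩
      ∣ roots? ∣                                               ≤⟨ count-∪ (∁? isDart?) (farRoot? ∪? spokeRoot?) roots? (λ r → r) (pairs n) ⟩
      ∣ ∁? isDart? ∣ + ∣ farRoot? ∪? spokeRoot? ∣              ≤⟨ +-monoʳ-≤ ∣ ∁? isDart? ∣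
                                                                    (≤-trans (count-∪ farRoot? spokeRoot? (farRoot? ∪? spokeRoot?) (λ r → r) (pairs n))
                                                                             (+-mono-≤ (∣graph∣≤∣domain∣ far? some-neighbour)
                                                                                       (∣graph∣≤∣domain∣ S′? (λ _ → u)))) ⟩
      ∣ ∁? isDart? ∣ + (V.∣ far? ∣ + V.∣ S′? ∣)                 ∎
      where
      open ≤-Reasoning
      roots? : Decidable (∁ IsDart ∪ (FarRoot ∪ SpokeRoot))
      roots? = ∁? isDart? ∪? (farRoot? ∪? spokeRoot?)

    S′<degree : suc V.∣ S′? ∣ ≤ degree G u
    S′<degree = V.∣∣-mono-< S′? (Adj? G u) proj₁ (τ-nbr (σ-nbr u~s₀)) λ (_ , s*≢s*) → s*≢s* refl

    many-darts : 2 * (faces + V.∣ far? ∣ + degree G u + 1) ≤ darts G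
    many-darts = begin
      2 * (F + W + k + 1)          ≡⟨ regroup₁ F W k ⟩
      (2 * F + 2 * W) + 2 * suc k  ≤⟨ +-monoˡ-≤ (2 * suc k) faces-vs-spokes ⟩
      (2 * s′ + r) + 2 * suc k     ≡⟨ regroup₄ s′ r k ⟩
      2 * suc s′ + (r + 2 * k)     ≤⟨ +-monoˡ-≤ (r + 2 * k) (*-monoʳ-≤ 2 S′<degree) ⟩
      2 * k + (r + 2 * k)          ≡⟨ regroup₅ k r ⟩
      r + 4 * k                    ≤⟨ outside₀+4*degree≤darts ⟩
      darts G                      ∎
      where
      open ≤-Reasoning
      F W k s′ r ND : ℕ
      F = faces
      W = V.∣ far? ∣
      k = degree G u
      s′ = V.∣ S′? ∣
      r = ∣ outside? E₀ ∣
      ND = ∣ ∁? isDart? ∣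
      regroup₁ : ∀ F W k → 2 * (F + W + k + 1) ≡ (2 * F + 2 * W) + 2 * suc k
      regroup₁ = solve-∀
      regroup₄ : ∀ s′ r k → (2 * s′ + r) + 2 * suc k ≡ 2 * suc s′ + (r + 2 * k)
      regroup₄ = solve-∀
      regroup₅ : ∀ k r → 2 * k + (r + 2 * k) ≡ r + 4 * k
      regroup₅ = solve-∀
      faces-vs-spokes : 2 * F + 2 * W ≤ 2 * s′ + r
      faces-vs-spokes = +-cancelˡ-≤ (2 * ND + 2 * W) _ _ (begin
        (2 * ND + 2 * W) + (2 * F + 2 * W)   ≡⟨ regroup₂ ND W F ⟩
        2 * (ND + F) + 4 * W                ≤⟨ +-mono-≤ (*-monoʳ-≤ 2 nondarts+faces≤orbits) (*-monoʳ-≤ 4 far≤untouched₀) ⟩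
        2 * orbitsOf full + 4 * V.∣ ∁? (touched? E₀) ∣ ≤⟨ euler-inequality connected E₀ u-touched₀ ⟩
        2 * orbitsOf E₀ + r                 ≤⟨ +-monoˡ-≤ r (*-monoʳ-≤ 2 orbits₀-bound) ⟩
        2 * (ND + (W + s′)) + r             ≡⟨ regroup₃ ND W s′ r ⟩
        (2 * ND + 2 * W) + (2 * s′ + r)     ∎)
        where
        regroup₂ : ∀ ND W F → (2 * ND + 2 * W) + (2 * F + 2 * W) ≡ 2 * (ND + F) + 4 * W
        regroup₂ = solve-∀
        regroup₃ : ∀ ND W s′ r → 2 * (ND + (W + s′)) + r ≡ (2 * ND + 2 * W) + (2 * s′ + r)
        regroup₃ = solve-∀

    not-spherical : n + darts G / 3 ≢ darts G / 2 + 2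
    not-spherical euler = 1+n≰n (begin
      suc (W + (2 + k) + F)       ≡⟨ regroup F W k ⟩
      (F + W + k + 1) + 2         ≤⟨ +-monoˡ-≤ 2 (n*m≤o⇒m≤o/n 2 many-darts) ⟩
      darts G / 2 + 2             ≡⟨ euler ⟨
      n + darts G / 3             ≤⟨ +-mono-≤ vertices≤far+2+degree (o≤n*m⇒o/n≤m 3 darts≤3*faces) ⟩
      W + (2 + k) + F             ∎)
      where
      open ≤-Reasoning
      F W k : ℕ
      F = faces
      W = V.∣ far? ∣
      k = degree G u
      regroup : ∀ F W k → suc (W + (2 + k) + F) ≡ (F + W + k + 1) + 2
      regroup = solve-∀

  τσ≡id : n + darts G / 3 ≡ darts G / 2 + 2 → ∀ {s} → S s → τ (σ s) ≡ s
  τσ≡id euler {s} u~s = decidable-stable (τ (σ s) ≟ s) λ τσs≢s → not-spherical u~s τσs≢s euler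

  module _ (τσ≡id : ∀ {s} → S s → τ (σ s) ≡ s) where

    τs≡ρ[s]u : ∀ {s} → S s → τ s ≡ ρ R s u
    τs≡ρ[s]u u~s = trans (cong τ (sym (σ[ρsu]≡s u~s))) (τσ≡id (ρ[s]u-nbr u~s))

    ρ[s]v≡σs : ∀ {s} → S s → ρ R s v ≡ σ s
    ρ[s]v≡σs u~s = ρ-inj R (third-adj (S⇒v~ u~s)) (S⇒v~ (σ-nbr u~s)) (trans (τ[ρsv]≡s u~s) (sym (τσ≡id u~s)))

    σ-adj : ∀ {s} → S s → Adj G s (σ s)
    σ-adj u~s = third-adj (adj-sym u~s)

    rotation-at-spoke : ∀ {s} → S s → iter (ρ R s) 4 u ≡ u
    rotation-at-spoke {s} u~s = begin
      ρ R s (ρ R s (ρ R s (ρ R s u))) ≡⟨ cong (ρ R s ∘ ρ R s ∘ ρ R s) (τs≡ρ[s]u u~s) ⟨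
      ρ R s (ρ R s (ρ R s (τ s)))     ≡⟨ cong (ρ R s ∘ ρ R s) (ρ[s][τs]≡v u~s) ⟩
      ρ R s (ρ R s v)                 ≡⟨ cong (ρ R s) (ρ[s]v≡σs u~s) ⟩
      ρ R s (σ s)                     ≡⟨ ρ[s][σs]≡u u~s ⟩
      u                               ∎
      where open ≡-Reasoning

    spoke-neighbours : ∀ {s y} → S s → Adj G s y → y ≡ u ⊎ y ≡ τ s ⊎ y ≡ v ⊎ y ≡ σ s
    spoke-neighbours {s} {y} u~s s~y
      with k , ρᵏu≡y ← ρ-cyclic R (adj-sym u~s) s~y
      with iter-reduce (ρ R s) {3} (rotation-at-spoke u~s) k
    ... | 0 , _ , ρ⁰u≡ρᵏu = inj₁ (trans (sym ρᵏu≡y) (sym ρ⁰u≡ρᵏu))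
    ... | 1 , _ , ρ¹u≡ρᵏu = inj₂ (inj₁ (trans (sym ρᵏu≡y) (trans (sym ρ¹u≡ρᵏu) (sym (τs≡ρ[s]u u~s)))))
    ... | 2 , _ , ρ²u≡ρᵏu = inj₂ (inj₂ (inj₁ (trans (sym ρᵏu≡y)
                              (trans (sym ρ²u≡ρᵏu) (trans (cong (ρ R s) (sym (τs≡ρ[s]u u~s))) (ρ[s][τs]≡v u~s))))))
    ... | 3 , _ , ρ³u≡ρᵏu = inj₂ (inj₂ (inj₂ (trans (sym ρᵏu≡y)
                              (trans (sym ρ³u≡ρᵏu) (trans (cong (ρ R s ∘ ρ R s) (sym (τs≡ρ[s]u u~s)))
                                                   (trans (cong (ρ R s) (ρ[s][τs]≡v u~s)) (ρ[s]v≡σs u~s)))))))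
    ... | suc (suc (suc (suc _))) , s≤s (s≤s (s≤s (s≤s ()))) , _

    rim-adj : ∀ {s t} → S s → S t → Adj G s t → t ≡ σ s ⊎ s ≡ σ t
    rim-adj {s} {t} u~s u~t s~t with spoke-neighbours u~s s~t
    ... | inj₁ t≡u               = ⊥-elim (S⇒¬UV u~t (inj₁ (sym t≡u)))
    ... | inj₂ (inj₁ t≡τs)       = inj₂ (trans (sym (σ[ρsu]≡s u~s)) (cong σ (trans (sym (τs≡ρ[s]u u~s)) (sym t≡τs))))
    ... | inj₂ (inj₂ (inj₁ t≡v)) = ⊥-elim (S⇒¬UV u~t (inj₂ (sym t≡v)))
    ... | inj₂ (inj₂ (inj₂ t≡σs)) = inj₁ t≡σs

    near-closed : ∀ {x y} → Near x → Adj G x y → Near y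
    near-closed (inj₁ (inj₁ refl)) u~y = inj₂ u~y
    near-closed (inj₁ (inj₂ refl)) v~y = inj₂ (v~⇒S v~y)
    near-closed (inj₂ u~x) x~y with spoke-neighbours u~x x~y
    ... | inj₁ refl                 = inj₁ (inj₁ refl)
    ... | inj₂ (inj₁ refl)          = inj₂ (τ-nbr u~x)
    ... | inj₂ (inj₂ (inj₁ refl))   = inj₁ (inj₂ refl)
    ... | inj₂ (inj₂ (inj₂ refl))   = inj₂ (σ-nbr u~x)

    all-near : ∀ x → Near x
    all-near x = decidable-stable (near? x) λ far →
      let _ , _ , y~z , near-y , far-z = leaving-edge G near? (connected u x) (inj₁ (inj₁ refl)) far
      in far-z (near-closed near-y y~z)

    everything-near : ∀ x → x ≡ u ⊎ x ≡ v ⊎ Adj G u x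
    everything-near x = Sum.map₁ sym (Sum.map₂ (Sum.map₁ sym) (Sum.assocʳ (all-near x)))

    isBipyramid : IsBipyramid G
    isBipyramid = BipyramidRecognition.isBipyramid G u≢v u≁v alike everything-near σ σ-nbr (ρ-cyclic R) σ-adj rim-adj
                    (proj₁ (proj₂ u-touched₀))

lemma6 : ∀ {n : ℕ} (G : SimpleGraph n) → MaximalPlanar G →
    (Σ (Fin n) λ u → Σ (Fin n) λ v → u ≢ v × Alike G u v) → IsBipyramid G
lemma6 G (connected , R , triangles , euler) (u , v , u≢v , alike) = isBipyramid (τσ≡id euler)
  where open AlikeVertices G R triangles connected u≢v alike
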